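{- Define integers $F'(n)$ and $G'(n)$, $n\ge 1$, by \[ \sum_{n=1}^\infty F'(n) q^n := \sum_{n=1}^\infty q^{n}(q^{n+1};q)_\infty (q^{n};q)_{n},\qquad \sum_{n=1}^\infty G'(n) q^n := \sum_{n=1}^\infty q^{n}(q^{n+1};q)_\infty (-q^{n};q)_{n}. \] Then \[ \text{(a)}\quad \sum_{n=1}^\infty q^{n}(q^{n+1};q)_\infty (q^{n};q)_{n} = \sum_{n\geq 1}(-1)^{n+1} q^{\frac{3n^2-n}{2}}, \] \[ \text{(b)}\quad \sum_{n=1}^\infty q^{n}(q^{n+1};q)_\infty (-q^{n};q)_{n} = \sum_{n\geq 1}(-1)^{n+1} q^{\frac{3n^2-n}{2}} + 2\sum_{n\geq 0} q^{6n^2+7n+2}. \]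
   Context: Here $q$ is a complex number with $|q|<1$ (equivalently, identities of formal power series in $q$). Notation: $(a;q)_0=1$, $(a;q)_n=\prod_{j=0}^{n-1}(1-aq^j)$, $(a;q)_\infty=\prod_{j=0}^{\infty}(1-aq^j)$. -}

module Defs where

open import Data.Nat as ℕ using (ℕ; zero; suc; _∸_)
open import Data.Nat.DivMod using (_/_)
open import Data.Integer as ℤ using (ℤ; 0ℤ; 1ℤ; -1ℤ)
open import Data.Bool using (if_then_else_)
open import Data.Nat using (_≡ᵇ_)

-- Formal power series in q with integer coefficients:
-- a series is its coefficient sequence, (f k) = coefficient of q^k.
PS : Set
PS = ℕ → ℤ

sumBelow : ℕ → (ℕ → ℤ) → ℤ
sumBelow zero    g = 0ℤ
sumBelow (suc n) g = sumBelow n g ℤ.+ g n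

one : PS
one zero    = 1ℤ
one (suc _) = 0ℤ

qpow : ℕ → PS
qpow e k = if e ≡ᵇ k then 1ℤ else 0ℤ

_⊕_ : PS → PS → PS
(f ⊕ g) k = f k ℤ.+ g k

_⊖_ : PS → PS → PS
(f ⊖ g) k = f k ℤ.- g k

_⊗_ : PS → PS → PS
(f ⊗ g) k = sumBelow (suc k) (λ i → f i ℤ.* g (k ∸ i))

infixl 7 _⊗_
infixl 6 _⊕_ _⊖_

_·_ : ℤ → PS → PS
(c · f) k = c ℤ.* f k

qPoch : PS → ℕ → PS
qPoch a zero    = one
qPoch a (suc n) = qPoch a n ⊗ (one ⊖ a ⊗ qpow n)

-- infinite q-Pochhammer symbol (a;q)_∞ for a series a with zero constant
-- term: the factor (1 - a q^j) is ≡ 1 mod q^(j+1), so the coefficient of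
-- q^k of the infinite product equals that of the partial product over
-- j = 0..k.
qPochInf : PS → PS
qPochInf a k = qPoch a (suc k) k

-- infinite sums Σ_{n≥1} f n and Σ_{n≥0} f n of families where q^n divides
-- f n (so the sum converges q-adically): the coefficient of q^k only
-- receives contributions from n ≤ k.
sumFrom1 : (ℕ → PS) → PS
sumFrom1 f k = sumBelow k (λ i → f (suc i) k)

sumFrom0 : (ℕ → PS) → PS
sumFrom0 f k = sumBelow (suc k) (λ n → f n k)

neg : PS → PS
neg f k = ℤ.- f k

pent : ℕ → ℕ
pent n = (n ℕ.* (3 ℕ.* n ∸ 1)) / 2

{-# OPTIONS --safe #-}
-- Expand (s q^n;q)_n by the q-binomial theorem and sum over n first. The coefficient of
-- (-s)^j q^(j(3j+1)/2) is then Σ_m q^((j+1)m) [m+j, j] (q^(m+j+1);q)_∞, which is 1: multiplied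
-- by (q;q)_j it becomes Σ_m q^((j+1)m) (q^(m+1);q)_∞, and this equals (q;q)_j by induction on j,
-- starting from a telescoping sum. Hence
--   Σ_{n ≥ 0} q^n (q^(n+1);q)_∞ (s q^n;q)_n = Σ_{j ≥ 0} (-s)^j q^(j(3j+1)/2).
-- The n = 0 term is (q;q)_∞, which Euler's pentagonal number theorem (obtained from Shanks'
-- finite identity) expands. For s = 1 this leaves (a); for s = -1 the even j cancel and
-- j = 2n+1 gives the exponents 6n² + 7n + 2 of (b).
module Submission where

open import Defs
open import Data.Nat using (ℕ; zero; suc; _+_; _*_; _∸_; _≤_; _<_; z≤n; s≤s)
import Data.Nat as ℕ
import Data.Nat.Properties as ℕ
import Data.Nat.Tactic.RingSolver as ℕ-Solver
open import Data.Nat.DivMod using (_/_; m*n/n≡m)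
open import Data.Nat.Induction using (<-rec)
open import Data.Integer using (ℤ; +_; 0ℤ; 1ℤ; -1ℤ; -_; _^_)
import Data.Integer as ℤ
import Data.Integer.Properties as ℤ
import Data.Integer.Tactic.RingSolver as ℤ-Solver
open import Data.Maybe using (Maybe; just; nothing)
open import Data.Product using (_×_; _,_)
open import Data.Sum using (inj₁; inj₂)
open import Function using (_∘_)
open import Level using (0ℓ)
open import Relation.Nullary using (yes; no; contradiction)
open import Relation.Binary.PropositionalEquality
  using (_≡_; _≢_; refl; sym; trans; cong; cong₂; module ≡-Reasoning)
import Relation.Binary.Reasoning.Setoid as SetoidReasoning
open import Algebra.Bundles using (CommutativeRing)
open import Algebra.Solver.Ring.AlmostCommutativeRing using (fromCommutativeRing; _-Raw-AlmostCommutative⟶_)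
import Algebra.Solver.Ring as RingSolver

sumBelow-cong : ∀ n {f g : ℕ → ℤ} → (∀ i → f i ≡ g i) → sumBelow n f ≡ sumBelow n g
sumBelow-cong zero    f≗g = refl
sumBelow-cong (suc n) f≗g = cong₂ ℤ._+_ (sumBelow-cong n f≗g) (f≗g n)

sumBelow-cong-< : ∀ n {f g : ℕ → ℤ} → (∀ i → i < n → f i ≡ g i) → sumBelow n f ≡ sumBelow n g
sumBelow-cong-< zero    f≗g = refl
sumBelow-cong-< (suc n) f≗g =
  cong₂ ℤ._+_ (sumBelow-cong-< n (λ i i<n → f≗g i (ℕ.m<n⇒m<1+n i<n))) (f≗g n ℕ.≤-refl)

sumBelow-zeros : ∀ n {f : ℕ → ℤ} → (∀ i → i < n → f i ≡ 0ℤ) → sumBelow n f ≡ 0ℤ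
sumBelow-zeros zero    f≗0 = refl
sumBelow-zeros (suc n) f≗0 =
  cong₂ ℤ._+_ (sumBelow-zeros n (λ i i<n → f≗0 i (ℕ.m<n⇒m<1+n i<n))) (f≗0 n ℕ.≤-refl)

sumBelow-+ : ∀ n (f g : ℕ → ℤ) → sumBelow n (λ i → f i ℤ.+ g i) ≡ sumBelow n f ℤ.+ sumBelow n g
sumBelow-+ zero    f g = refl
sumBelow-+ (suc n) f g =
  trans (cong (ℤ._+ (f n ℤ.+ g n)) (sumBelow-+ n f g))
        (interchange (sumBelow n f) (sumBelow n g) (f n) (g n))
  where
  interchange : ∀ a b c d → (a ℤ.+ b) ℤ.+ (c ℤ.+ d) ≡ (a ℤ.+ c) ℤ.+ (b ℤ.+ d)
  interchange = ℤ-Solver.solve-∀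

sumBelow-neg : ∀ n (f : ℕ → ℤ) → sumBelow n (λ i → - f i) ≡ - sumBelow n f
sumBelow-neg zero    f = refl
sumBelow-neg (suc n) f =
  trans (cong (ℤ._+ (- f n)) (sumBelow-neg n f)) (sym (ℤ.neg-distrib-+ (sumBelow n f) (f n)))

sumBelow-- : ∀ n (f g : ℕ → ℤ) → sumBelow n (λ i → f i ℤ.- g i) ≡ sumBelow n f ℤ.- sumBelow n g
sumBelow-- n f g =
  trans (sumBelow-+ n f (λ i → - g i)) (cong (λ s → sumBelow n f ℤ.+ s) (sumBelow-neg n g))

sumBelow-*ˡ : ∀ n c (f : ℕ → ℤ) → sumBelow n (λ i → c ℤ.* f i) ≡ c ℤ.* sumBelow n f
sumBelow-*ˡ zero    c f = sym (ℤ.*-zeroʳ c)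
sumBelow-*ˡ (suc n) c f =
  trans (cong (ℤ._+ (c ℤ.* f n)) (sumBelow-*ˡ n c f)) (sym (ℤ.*-distribˡ-+ c (sumBelow n f) (f n)))

sumBelow-*ʳ : ∀ n c (f : ℕ → ℤ) → sumBelow n (λ i → f i ℤ.* c) ≡ sumBelow n f ℤ.* c
sumBelow-*ʳ n c f = begin
  sumBelow n (λ i → f i ℤ.* c)  ≡⟨ sumBelow-cong n (λ i → ℤ.*-comm (f i) c) ⟩
  sumBelow n (λ i → c ℤ.* f i)  ≡⟨ sumBelow-*ˡ n c f ⟩
  c ℤ.* sumBelow n f            ≡⟨ ℤ.*-comm c (sumBelow n f) ⟩
  sumBelow n f ℤ.* c            ∎
  where open ≡-Reasoning

sumBelow-head : ∀ n (f : ℕ → ℤ) → sumBelow (suc n) f ≡ f 0 ℤ.+ sumBelow n (λ i → f (suc i))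
sumBelow-head zero    f = trans (ℤ.+-identityˡ (f 0)) (sym (ℤ.+-identityʳ (f 0)))
sumBelow-head (suc n) f = trans (cong (ℤ._+ f (suc n)) (sumBelow-head n f)) (ℤ.+-assoc (f 0) _ _)

sumBelow-vanishing-tail : ∀ {n N} (f : ℕ → ℤ) → n ≤ N → (∀ i → n ≤ i → i < N → f i ≡ 0ℤ) →
                          sumBelow N f ≡ sumBelow n f
sumBelow-vanishing-tail {n} f n≤N = go (ℕ.≤⇒≤′ n≤N)
  where
  go : ∀ {N} → n ℕ.≤′ N → (∀ i → n ≤ i → i < N → f i ≡ 0ℤ) → sumBelow N f ≡ sumBelow n f
  go ℕ.≤′-refl         _    = refl
  go (ℕ.≤′-step {N} p) tail =
    trans (cong₂ ℤ._+_ (go p (λ i n≤i i<N → tail i n≤i (ℕ.m<n⇒m<1+n i<N)))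
                       (tail N (ℕ.≤′⇒≤ p) ℕ.≤-refl))
          (ℤ.+-identityʳ _)

sumBelow-comm : ∀ m n (F : ℕ → ℕ → ℤ) →
                sumBelow m (λ i → sumBelow n (F i)) ≡ sumBelow n (λ j → sumBelow m (λ i → F i j))
sumBelow-comm zero    n F = sym (sumBelow-zeros n (λ _ _ → refl))
sumBelow-comm (suc m) n F =
  trans (cong (ℤ._+ sumBelow n (F m)) (sumBelow-comm m n F))
        (sym (sumBelow-+ n (λ j → sumBelow m (λ i → F i j)) (F m)))

sumBelow-triangle : ∀ N (G : ℕ → ℕ → ℤ) →
                    sumBelow N (λ n → sumBelow (suc n) (G n))
                    ≡ sumBelow N (λ j → sumBelow (N ∸ j) (λ m → G (m + j) j))
sumBelow-triangle zero    G = refl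
sumBelow-triangle (suc N) G = begin
  sumBelow N (λ n → sumBelow (suc n) (G n)) ℤ.+ sumBelow (suc N) (G N)
    ≡⟨ cong (ℤ._+ sumBelow (suc N) (G N)) (sumBelow-triangle N G) ⟩
  sumBelow N column ℤ.+ sumBelow (suc N) (G N)
    ≡⟨ cong (ℤ._+ sumBelow (suc N) (G N)) (sym (sumBelow-vanishing-tail column (ℕ.n≤1+n N) last-column-empty)) ⟩
  sumBelow (suc N) column ℤ.+ sumBelow (suc N) (G N)
    ≡⟨ sym (sumBelow-+ (suc N) column (G N)) ⟩
  sumBelow (suc N) (λ j → column j ℤ.+ G N j)
    ≡⟨ sumBelow-cong-< (suc N) extend-column ⟩
  sumBelow (suc N) (λ j → sumBelow (suc N ∸ j) (λ m → G (m + j) j))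
    ∎
  where
  open ≡-Reasoning
  column : ℕ → ℤ
  column j = sumBelow (N ∸ j) (λ m → G (m + j) j)
  last-column-empty : ∀ i → N ≤ i → i < suc N → column i ≡ 0ℤ
  last-column-empty i N≤i (s≤s i≤N) rewrite ℕ.≤-antisym i≤N N≤i | ℕ.n∸n≡0 N = refl
  extend-column : ∀ j → j < suc N → column j ℤ.+ G N j ≡ sumBelow (suc N ∸ j) (λ m → G (m + j) j)
  extend-column j (s≤s j≤N) rewrite ℕ.+-∸-assoc 1 j≤N =
    cong (λ t → column j ℤ.+ G t j) (sym (ℕ.m∸n+n≡m j≤N))

sumBelow-reverse : ∀ n (f : ℕ → ℤ) → sumBelow n f ≡ sumBelow n (λ i → f (n ∸ suc i))
sumBelow-reverse zero    f = refl
sumBelow-reverse (suc n) f = begin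
  sumBelow n f ℤ.+ f n                         ≡⟨ cong (ℤ._+ f n) (sumBelow-reverse n f) ⟩
  sumBelow n (λ i → f (n ∸ suc i)) ℤ.+ f n     ≡⟨ ℤ.+-comm _ (f n) ⟩
  f n ℤ.+ sumBelow n (λ i → f (n ∸ suc i))     ≡⟨ sym (sumBelow-head n (λ i → f (n ∸ i))) ⟩
  sumBelow (suc n) (λ i → f (n ∸ i))           ∎
  where open ≡-Reasoning

sumBelow-telescope : ∀ n (f : ℕ → ℤ) → sumBelow n (λ m → f (suc m) ℤ.- f m) ≡ f n ℤ.- f 0
sumBelow-telescope zero    f = sym (ℤ.+-inverseʳ (f 0))
sumBelow-telescope (suc n) f =
  trans (cong (ℤ._+ (f (suc n) ℤ.- f n)) (sumBelow-telescope n f)) (cancel (f n) (f 0) (f (suc n)))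
  where
  cancel : ∀ a b c → (a ℤ.- b) ℤ.+ (c ℤ.- a) ≡ c ℤ.- b
  cancel = ℤ-Solver.solve-∀

sumBelow-even-odd : ∀ n (f : ℕ → ℤ) →
                    sumBelow (2 * n) f ≡ sumBelow n (λ i → f (2 * i)) ℤ.+ sumBelow n (λ i → f (suc (2 * i)))
sumBelow-even-odd zero    f = refl
sumBelow-even-odd (suc n) f rewrite ℕ.+-suc n (n + 0) =
  trans (cong (λ s → s ℤ.+ f (2 * n) ℤ.+ f (suc (2 * n))) (sumBelow-even-odd n f))
        (interchange (sumBelow n (λ i → f (2 * i))) (sumBelow n (λ i → f (suc (2 * i))))
                     (f (2 * n)) (f (suc (2 * n))))
  where
  interchange : ∀ a b c d → a ℤ.+ b ℤ.+ c ℤ.+ d ≡ (a ℤ.+ c) ℤ.+ (b ℤ.+ d)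
  interchange = ℤ-Solver.solve-∀

-- The ring of formal power series

infix 4 _≈_
record _≈_ (f g : PS) : Set where
  constructor coeffwise
  field coeff : ∀ k → f k ≡ g k
open _≈_ public

zeroPS : PS
zeroPS _ = 0ℤ

⊗-cong : ∀ {f f′ g g′} → f ≈ f′ → g ≈ g′ → f ⊗ g ≈ f′ ⊗ g′
⊗-cong f≈f′ g≈g′ = coeffwise λ k →
  sumBelow-cong (suc k) (λ i → cong₂ ℤ._*_ (coeff f≈f′ i) (coeff g≈g′ (k ∸ i)))

⊗-comm : ∀ f g → f ⊗ g ≈ g ⊗ f
⊗-comm f g = coeffwise λ k → trans (sumBelow-reverse (suc k) (λ i → f i ℤ.* g (k ∸ i)))
  (sumBelow-cong-< (suc k) λ i i≤k →
    trans (cong (λ j → f (k ∸ i) ℤ.* g j) (ℕ.m∸[m∸n]≡n (ℕ.≤-pred i≤k))) (ℤ.*-comm (f (k ∸ i)) (g i)))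

⊗-assoc : ∀ f g h → (f ⊗ g) ⊗ h ≈ f ⊗ (g ⊗ h)
⊗-assoc f g h = coeffwise λ k → begin
    sumBelow (suc k) (λ n → sumBelow (suc n) (λ j → f j ℤ.* g (n ∸ j)) ℤ.* h (k ∸ n))
  ≡⟨ sumBelow-cong (suc k) (λ n → sym (sumBelow-*ʳ (suc n) (h (k ∸ n)) _)) ⟩
    sumBelow (suc k) (λ n → sumBelow (suc n) (λ j → f j ℤ.* g (n ∸ j) ℤ.* h (k ∸ n)))
  ≡⟨ sumBelow-triangle (suc k) (λ n j → f j ℤ.* g (n ∸ j) ℤ.* h (k ∸ n)) ⟩
    sumBelow (suc k) (λ j → sumBelow (suc k ∸ j) (λ m → f j ℤ.* g (m + j ∸ j) ℤ.* h (k ∸ (m + j))))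
  ≡⟨ sumBelow-cong-< (suc k) (λ j j≤k → factor-out k j (ℕ.≤-pred j≤k)) ⟩
    sumBelow (suc k) (λ j → f j ℤ.* sumBelow (suc (k ∸ j)) (λ m → g m ℤ.* h (k ∸ j ∸ m)))
  ∎
  where
  open ≡-Reasoning
  factor-out : ∀ k j → j ≤ k →
               sumBelow (suc k ∸ j) (λ m → f j ℤ.* g (m + j ∸ j) ℤ.* h (k ∸ (m + j)))
               ≡ f j ℤ.* sumBelow (suc (k ∸ j)) (λ m → g m ℤ.* h (k ∸ j ∸ m))
  factor-out k j j≤k rewrite ℕ.+-∸-assoc 1 j≤k =
    trans (sumBelow-cong (suc (k ∸ j)) reassociate) (sumBelow-*ˡ (suc (k ∸ j)) (f j) _)
    where
    reassociate : ∀ m → f j ℤ.* g (m + j ∸ j) ℤ.* h (k ∸ (m + j)) ≡ f j ℤ.* (g m ℤ.* h (k ∸ j ∸ m))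
    reassociate m rewrite ℕ.m+n∸n≡m m j | ℕ.+-comm m j | sym (ℕ.∸-+-assoc k j m) =
      ℤ.*-assoc (f j) (g m) _

⊗-distribʳ : ∀ f g h → (g ⊕ h) ⊗ f ≈ g ⊗ f ⊕ h ⊗ f
⊗-distribʳ f g h = coeffwise λ k →
  trans (sumBelow-cong (suc k) (λ i → ℤ.*-distribʳ-+ (f (k ∸ i)) (g i) (h i))) (sumBelow-+ (suc k) _ _)

⊗-distribˡ : ∀ f g h → f ⊗ (g ⊕ h) ≈ f ⊗ g ⊕ f ⊗ h
⊗-distribˡ f g h = coeffwise λ k →
  trans (sumBelow-cong (suc k) (λ i → ℤ.*-distribˡ-+ (f i) (g (k ∸ i)) (h (k ∸ i)))) (sumBelow-+ (suc k) _ _)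

⊗-identityˡ : ∀ f → one ⊗ f ≈ f
⊗-identityˡ f = coeffwise λ k → trans (sumBelow-head k (λ i → one i ℤ.* f (k ∸ i)))
  (trans (cong₂ ℤ._+_ (ℤ.*-identityˡ (f k)) (sumBelow-zeros k (λ _ _ → refl))) (ℤ.+-identityʳ (f k)))

⊗-identityʳ : ∀ f → f ⊗ one ≈ f
⊗-identityʳ f = coeffwise λ k → trans (coeff (⊗-comm f one) k) (coeff (⊗-identityˡ f) k)

psRing : CommutativeRing 0ℓ 0ℓ
psRing = record
  { Carrier = PS ; _≈_ = _≈_ ; _+_ = _⊕_ ; _*_ = _⊗_ ; -_ = neg ; 0# = zeroPS ; 1# = one
  ; isCommutativeRing = record
    { isRing = record
      { +-isAbelianGroup = record
        { isGroup = record
          { isMonoid = record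
            { isSemigroup = record
              { isMagma = record
                { isEquivalence = record
                  { refl  = coeffwise λ _ → refl
                  ; sym   = λ f≈g → coeffwise λ k → sym (coeff f≈g k)
                  ; trans = λ f≈g g≈h → coeffwise λ k → trans (coeff f≈g k) (coeff g≈h k) }
                ; ∙-cong = λ f≈f′ g≈g′ → coeffwise λ k → cong₂ ℤ._+_ (coeff f≈f′ k) (coeff g≈g′ k) }
              ; assoc = λ f g h → coeffwise λ k → ℤ.+-assoc (f k) (g k) (h k) }
            ; identity = (λ f → coeffwise λ k → ℤ.+-identityˡ (f k))
                       , (λ f → coeffwise λ k → ℤ.+-identityʳ (f k)) }
          ; inverse = (λ f → coeffwise λ k → ℤ.+-inverseˡ (f k))
                    , (λ f → coeffwise λ k → ℤ.+-inverseʳ (f k))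
          ; ⁻¹-cong = λ f≈g → coeffwise λ k → cong -_ (coeff f≈g k) }
        ; comm = λ f g → coeffwise λ k → ℤ.+-comm (f k) (g k) }
      ; *-cong = ⊗-cong
      ; *-assoc = ⊗-assoc
      ; *-identity = ⊗-identityˡ , ⊗-identityʳ
      ; distrib = ⊗-distribˡ , ⊗-distribʳ }
    ; *-comm = ⊗-comm } }

open CommutativeRing psRing
  using (setoid; +-cong; -‿cong; *-assoc; *-comm; *-identityˡ; *-identityʳ; zeroˡ; zeroʳ)
  renaming (refl to ≈-refl; sym to ≈-sym; trans to ≈-trans; reflexive to ≈-reflexive)

module ≈-Reasoning = SetoidReasoning setoid

-- The fixed factor is explicit: Agda cannot infer a series from its coefficients.
⊗-congˡ : ∀ f {g g′} → g ≈ g′ → f ⊗ g ≈ f ⊗ g′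
⊗-congˡ f = ⊗-cong (≈-refl {f})

⊗-congʳ : ∀ g {f f′} → f ≈ f′ → f ⊗ g ≈ f′ ⊗ g
⊗-congʳ g f≈f′ = ⊗-cong f≈f′ (≈-refl {g})

⊖-congˡ : ∀ f {g g′} → g ≈ g′ → f ⊖ g ≈ f ⊖ g′
⊖-congˡ f g≈g′ = coeffwise λ k → cong (λ c → f k ℤ.- c) (coeff g≈g′ k)

-- 0 and 1 are sent to zeroPS and one themselves, so that the solver's constants
-- are definitionally the series that occur in goals.
const : ℤ → PS
const (+ 0) = zeroPS
const (+ 1) = one
const c       = c · one

const-coeff : ∀ c k → const c k ≡ c ℤ.* one k
const-coeff (+ 0)           zero    = refl
const-coeff (+ 0)           (suc k) = refl
const-coeff (+ 1)           zero    = refl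
const-coeff (+ 1)           (suc k) = refl
const-coeff (+ suc (suc n)) k       = refl
const-coeff ℤ.-[1+ n ]        k       = refl

const-⊗ : ∀ c f k → (const c ⊗ f) k ≡ c ℤ.* f k
const-⊗ c f k = begin
  sumBelow (suc k) (λ i → const c i ℤ.* f (k ∸ i))
    ≡⟨ sumBelow-cong (suc k) (λ i → trans (cong (ℤ._* f (k ∸ i)) (const-coeff c i)) (ℤ.*-assoc c (one i) _)) ⟩
  sumBelow (suc k) (λ i → c ℤ.* (one i ℤ.* f (k ∸ i)))
    ≡⟨ sumBelow-*ˡ (suc k) c _ ⟩
  c ℤ.* (one ⊗ f) k
    ≡⟨ cong (c ℤ.*_) (coeff (⊗-identityˡ f) k) ⟩
  c ℤ.* f k
    ∎
  where open ≡-Reasoning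

const-homomorphism : ℤ.+-*-rawRing -Raw-AlmostCommutative⟶ fromCommutativeRing psRing
const-homomorphism = record
  { ⟦_⟧ = const
  ; +-homo = λ c d → coeffwise λ k → begin
      const (c ℤ.+ d) k                   ≡⟨ const-coeff (c ℤ.+ d) k ⟩
      (c ℤ.+ d) ℤ.* one k                 ≡⟨ ℤ.*-distribʳ-+ (one k) c d ⟩
      c ℤ.* one k ℤ.+ d ℤ.* one k         ≡⟨ sym (cong₂ ℤ._+_ (const-coeff c k) (const-coeff d k)) ⟩
      const c k ℤ.+ const d k             ∎
  ; *-homo = λ c d → coeffwise λ k → begin
      const (c ℤ.* d) k                   ≡⟨ const-coeff (c ℤ.* d) k ⟩
      c ℤ.* d ℤ.* one k                   ≡⟨ ℤ.*-assoc c d (one k) ⟩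
      c ℤ.* (d ℤ.* one k)                 ≡⟨ cong (c ℤ.*_) (sym (const-coeff d k)) ⟩
      c ℤ.* const d k                     ≡⟨ sym (const-⊗ c (const d) k) ⟩
      (const c ⊗ const d) k               ∎
  ; -‿homo = λ c → coeffwise λ k → begin
      const (- c) k                       ≡⟨ const-coeff (- c) k ⟩
      - c ℤ.* one k                       ≡⟨ sym (ℤ.neg-distribˡ-* c (one k)) ⟩
      - (c ℤ.* one k)                     ≡⟨ cong -_ (sym (const-coeff c k)) ⟩
      - const c k                         ∎
  ; 0-homo = ≈-refl
  ; 1-homo = ≈-refl }
  where open ≡-Reasoning

const-≟ : ∀ c d → Maybe (const c ≈ const d)
const-≟ c d with c ℤ.≟ d
... | yes refl = just ≈-refl
... | no _     = nothing

open RingSolver ℤ.+-*-rawRing (fromCommutativeRing psRing) const-homomorphism const-≟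

const-neg-pow : ∀ s j → const ((- s) ^ suc j) ≈ neg (const s) ⊗ const ((- s) ^ j)
const-neg-pow s j = ≈-trans (*-homo (- s) ((- s) ^ j)) (⊗-congʳ (const ((- s) ^ j)) (-‿homo s))
  where open _-Raw-AlmostCommutative⟶_ const-homomorphism

⊗-unit-no-zero-divisor : ∀ c {d} → c 0 ≡ 1ℤ → c ⊗ d ≈ zeroPS → d ≈ zeroPS
⊗-unit-no-zero-divisor c {d} c₀≡1 cd≈0 = coeffwise (<-rec _ vanish)
  where
  vanish : ∀ k → (∀ {i} → i < k → d i ≡ 0ℤ) → d k ≡ 0ℤ
  vanish k below = begin
    d k                                           ≡⟨ sym (ℤ.*-identityˡ (d k)) ⟩
    1ℤ ℤ.* d k                                    ≡⟨ cong (ℤ._* d k) (sym c₀≡1) ⟩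
    c 0 ℤ.* d k                                   ≡⟨ sym (ℤ.+-identityʳ _) ⟩
    c 0 ℤ.* d k ℤ.+ 0ℤ
      ≡⟨ cong (λ s → c 0 ℤ.* d k ℤ.+ s) (sym (sumBelow-zeros k later)) ⟩
    c 0 ℤ.* d k ℤ.+ sumBelow k (λ i → c (suc i) ℤ.* d (k ∸ suc i))
      ≡⟨ sym (sumBelow-head k (λ i → c i ℤ.* d (k ∸ i))) ⟩
    (c ⊗ d) k                                     ≡⟨ coeff cd≈0 k ⟩
    0ℤ                                            ∎
    where
    open ≡-Reasoning
    later : ∀ i → i < k → c (suc i) ℤ.* d (k ∸ suc i) ≡ 0ℤ
    later i i<k = trans (cong (c (suc i) ℤ.*_) (below (ℕ.∸-monoʳ-< (s≤s z≤n) i<k))) (ℤ.*-zeroʳ (c (suc i)))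

⊗-cancelˡ : ∀ c {f g} → c 0 ≡ 1ℤ → c ⊗ f ≈ c ⊗ g → f ≈ g
⊗-cancelˡ c {f} {g} c₀≡1 cf≈cg = coeffwise λ k → ℤ.i-j≡0⇒i≡j (f k) (g k) (coeff f-g≈0 k)
  where
  f-g≈0 : f ⊖ g ≈ zeroPS
  f-g≈0 = ⊗-unit-no-zero-divisor c c₀≡1 (begin
    c ⊗ (f ⊖ g)        ≈⟨ distribute c f g ⟩
    c ⊗ f ⊖ c ⊗ g      ≈⟨ +-cong cf≈cg (≈-refl {neg (c ⊗ g)}) ⟩
    c ⊗ g ⊖ c ⊗ g      ≈⟨ coeffwise (λ k → ℤ.+-inverseʳ ((c ⊗ g) k)) ⟩
    zeroPS             ∎)
    where
    open ≈-Reasoning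
    distribute : ∀ c f g → c ⊗ (f ⊖ g) ≈ c ⊗ f ⊖ c ⊗ g
    distribute = solve 3 (λ c f g → c :* (f :- g) := c :* f :- c :* g) ≈-refl

qpow-diag : ∀ e → qpow e e ≡ 1ℤ
qpow-diag zero    = refl
qpow-diag (suc e) = qpow-diag e

qpow-off : ∀ {e k} → e ≢ k → qpow e k ≡ 0ℤ
qpow-off {zero}  {zero}  e≢k = contradiction refl e≢k
qpow-off {zero}  {suc k} _   = refl
qpow-off {suc e} {zero}  _   = refl
qpow-off {suc e} {suc k} e≢k = qpow-off (e≢k ∘ cong suc)

qpow-+ : ∀ a e k → qpow (a + e) (a + k) ≡ qpow e k
qpow-+ zero    e k = refl
qpow-+ (suc a) e k = qpow-+ a e k

qpow-cong : ∀ {a b} → a ≡ b → qpow a ≈ qpow b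
qpow-cong refl = ≈-refl

qpow-zero : qpow 0 ≈ one
qpow-zero = coeffwise λ { zero → refl ; (suc k) → refl }

sumBelow-qpow : ∀ n e (g : ℕ → ℤ) → e < n → sumBelow n (λ i → qpow e i ℤ.* g i) ≡ g e
sumBelow-qpow n e g e<n = begin
  sumBelow n h
    ≡⟨ sumBelow-vanishing-tail h e<n (λ i e<i _ → cong (ℤ._* g i) (qpow-off (ℕ.<⇒≢ e<i))) ⟩
  sumBelow e h ℤ.+ qpow e e ℤ.* g e
    ≡⟨ cong₂ ℤ._+_ (sumBelow-zeros e (λ i i<e → cong (ℤ._* g i) (qpow-off (ℕ.>⇒≢ i<e))))
                   (cong (ℤ._* g e) (qpow-diag e)) ⟩
  0ℤ ℤ.+ 1ℤ ℤ.* g e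
    ≡⟨ trans (ℤ.+-identityˡ _) (ℤ.*-identityˡ (g e)) ⟩
  g e
    ∎
  where
  open ≡-Reasoning
  h : ℕ → ℤ
  h i = qpow e i ℤ.* g i

qpow-⊗-below : ∀ e f {k} → k < e → (qpow e ⊗ f) k ≡ 0ℤ
qpow-⊗-below e f k<e = sumBelow-zeros _ λ i i≤k →
  cong (ℤ._* _) (qpow-off (ℕ.>⇒≢ (ℕ.≤-<-trans (ℕ.≤-pred i≤k) k<e)))

qpow-⊗-shift : ∀ e f k → (qpow e ⊗ f) (e + k) ≡ f k
qpow-⊗-shift e f k =
  trans (sumBelow-qpow (suc (e + k)) e (λ i → f (e + k ∸ i)) (s≤s (ℕ.m≤m+n e k))) (cong f (ℕ.m+n∸m≡n e k))

qpow-⊗-qpow : ∀ a b → qpow a ⊗ qpow b ≈ qpow (a + b)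
qpow-⊗-qpow a b = coeffwise coefficient
  where
  coefficient : ∀ k → (qpow a ⊗ qpow b) k ≡ qpow (a + b) k
  coefficient k with k ℕ.<? a
  ... | yes k<a =
    trans (qpow-⊗-below a (qpow b) k<a) (sym (qpow-off (ℕ.>⇒≢ (ℕ.<-≤-trans k<a (ℕ.m≤m+n a b)))))
  ... | no  k≮a = begin
    (qpow a ⊗ qpow b) k              ≡⟨ cong (qpow a ⊗ qpow b) (sym a+[k∸a]≡k) ⟩
    (qpow a ⊗ qpow b) (a + (k ∸ a))  ≡⟨ qpow-⊗-shift a (qpow b) (k ∸ a) ⟩
    qpow b (k ∸ a)                   ≡⟨ sym (qpow-+ a b (k ∸ a)) ⟩
    qpow (a + b) (a + (k ∸ a))       ≡⟨ cong (qpow (a + b)) a+[k∸a]≡k ⟩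
    qpow (a + b) k                   ∎
    where
    open ≡-Reasoning
    a+[k∸a]≡k : a + (k ∸ a) ≡ k
    a+[k∸a]≡k = ℕ.m+[n∸m]≡n (ℕ.≮⇒≥ k≮a)

infix 4 q^_∣_
q^_∣_ : ℕ → PS → Set
q^ m ∣ f = ∀ k → k < m → f k ≡ 0ℤ

q^∣qpow : ∀ e → q^ e ∣ qpow e
q^∣qpow e k k<e = qpow-off (ℕ.>⇒≢ k<e)

q^∣-⊗ˡ : ∀ {m f} g → q^ m ∣ f → q^ m ∣ f ⊗ g
q^∣-⊗ˡ {m} {f} g m∣f k k<m = sumBelow-zeros (suc k) λ i i≤k →
  trans (cong (ℤ._* g (k ∸ i)) (m∣f i (ℕ.≤-<-trans (ℕ.≤-pred i≤k) k<m))) (ℤ.*-zeroˡ (g (k ∸ i)))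

q^∣-⊗ʳ : ∀ {m g} f → q^ m ∣ g → q^ m ∣ f ⊗ g
q^∣-⊗ʳ {g = g} f m∣g k k<m = trans (coeff (⊗-comm f g) k) (q^∣-⊗ˡ f m∣g k k<m)

q^∣-weaken : ∀ {m n f} → m ≤ n → q^ n ∣ f → q^ m ∣ f
q^∣-weaken m≤n n∣f k k<m = n∣f k (ℕ.<-≤-trans k<m m≤n)

q^∣qpow-multiple : ∀ a m → q^ m ∣ qpow (suc a * m)
q^∣qpow-multiple a m = q^∣-weaken (ℕ.m≤m+n m (a * m)) (q^∣qpow (suc a * m))

⊗-coeff-localʳ : ∀ f {g g′} k → (∀ i → i ≤ k → g i ≡ g′ i) → (f ⊗ g) k ≡ (f ⊗ g′) k
⊗-coeff-localʳ f k g≗g′ =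
  sumBelow-cong-< (suc k) (λ i _ → cong (f i ℤ.*_) (g≗g′ (k ∸ i) (ℕ.m∸n≤m k i)))

1-q^_ : ℕ → PS
1-q^ e = one ⊖ qpow e

P∞ : ℕ → PS
P∞ a = qPochInf (qpow a)

1-q^0≈0 : 1-q^ 0 ≈ zeroPS
1-q^0≈0 = coeffwise λ k → trans (coeff (⊖-congˡ one qpow-zero) k) (ℤ.+-inverseʳ (one k))

⊗-1-q^-below : ∀ f {e k} → k < e → (f ⊗ 1-q^ e) k ≡ f k
⊗-1-q^-below f {e} {k} k<e = begin
  (f ⊗ 1-q^ e) k           ≡⟨ coeff (distribute f (qpow e)) k ⟩
  f k ℤ.- (f ⊗ qpow e) k   ≡⟨ cong (λ c → f k ℤ.- c) (coeff (⊗-comm f (qpow e)) k) ⟩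
  f k ℤ.- (qpow e ⊗ f) k   ≡⟨ cong (λ c → f k ℤ.- c) (qpow-⊗-below e f k<e) ⟩
  f k ℤ.- 0ℤ               ≡⟨ ℤ.+-identityʳ (f k) ⟩
  f k                      ∎
  where
  open ≡-Reasoning
  distribute : ∀ f x → f ⊗ (one ⊖ x) ≈ f ⊖ f ⊗ x
  distribute = solve 2 (λ f x → f :* (con 1ℤ :- x) := f :- f :* x) ≈-refl

qPoch-cong : ∀ {a a′} n → a ≈ a′ → qPoch a n ≈ qPoch a′ n
qPoch-cong zero    a≈a′ = ≈-refl
qPoch-cong (suc n) a≈a′ = ⊗-cong (qPoch-cong n a≈a′) (⊖-congˡ one (⊗-congʳ (qpow n) a≈a′))

qPoch-qpow-last : ∀ a n → qPoch (qpow a) (suc n) ≈ qPoch (qpow a) n ⊗ 1-q^ (a + n)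
qPoch-qpow-last a n = ⊗-congˡ (qPoch (qpow a) n) (⊖-congˡ one (qpow-⊗-qpow a n))

qPoch-qpow-first : ∀ a n → qPoch (qpow a) (suc n) ≈ 1-q^ a ⊗ qPoch (qpow (suc a)) n
qPoch-qpow-first a zero = begin
  qPoch (qpow a) 1    ≈⟨ qPoch-qpow-last a 0 ⟩
  one ⊗ 1-q^ (a + 0)  ≈⟨ *-identityˡ (1-q^ (a + 0)) ⟩
  1-q^ (a + 0)        ≈⟨ ≈-reflexive (cong 1-q^_ (ℕ.+-identityʳ a)) ⟩
  1-q^ a              ≈⟨ ≈-sym (*-identityʳ (1-q^ a)) ⟩
  1-q^ a ⊗ one        ∎
  where open ≈-Reasoning
qPoch-qpow-first a (suc n) = begin
  qPoch (qpow a) (suc (suc n))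
    ≈⟨ qPoch-qpow-last a (suc n) ⟩
  qPoch (qpow a) (suc n) ⊗ 1-q^ (a + suc n)
    ≈⟨ ⊗-congʳ (1-q^ (a + suc n)) (qPoch-qpow-first a n) ⟩
  1-q^ a ⊗ Q ⊗ 1-q^ (a + suc n)
    ≈⟨ *-assoc (1-q^ a) Q (1-q^ (a + suc n)) ⟩
  1-q^ a ⊗ (Q ⊗ 1-q^ (a + suc n))
    ≈⟨ ⊗-congˡ (1-q^ a) (⊗-congˡ Q (≈-reflexive (cong 1-q^_ (ℕ.+-suc a n)))) ⟩
  1-q^ a ⊗ (Q ⊗ 1-q^ (suc a + n))
    ≈⟨ ⊗-congˡ (1-q^ a) (≈-sym (qPoch-qpow-last (suc a) n)) ⟩
  1-q^ a ⊗ qPoch (qpow (suc a)) (suc n)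
    ∎
  where
  open ≈-Reasoning
  Q : PS
  Q = qPoch (qpow (suc a)) n

qPoch-qpow-extend : ∀ a {n n′ k} → n ≤ n′ → k < a + n → qPoch (qpow a) n′ k ≡ qPoch (qpow a) n k
qPoch-qpow-extend a {n} {k = k} n≤n′ k<a+n = go (ℕ.≤⇒≤′ n≤n′)
  where
  go : ∀ {n′} → n ℕ.≤′ n′ → qPoch (qpow a) n′ k ≡ qPoch (qpow a) n k
  go ℕ.≤′-refl          = refl
  go (ℕ.≤′-step {n′} p) = begin
    qPoch (qpow a) (suc n′) k              ≡⟨ coeff (qPoch-qpow-last a n′) k ⟩
    (qPoch (qpow a) n′ ⊗ 1-q^ (a + n′)) k  ≡⟨ ⊗-1-q^-below (qPoch (qpow a) n′) k<a+n′ ⟩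
    qPoch (qpow a) n′ k                    ≡⟨ go p ⟩
    qPoch (qpow a) n k                     ∎
    where
    open ≡-Reasoning
    k<a+n′ : k < a + n′
    k<a+n′ = ℕ.<-≤-trans k<a+n (ℕ.+-monoʳ-≤ a (ℕ.≤′⇒≤ p))

qPoch-qpow-stable : ∀ a n k → k < a + n → qPoch (qpow a) n k ≡ P∞ a k
qPoch-qpow-stable a n k k<a+n with ℕ.≤-total n (suc k)
... | inj₁ n≤1+k = sym (qPoch-qpow-extend a n≤1+k k<a+n)
... | inj₂ 1+k≤n = qPoch-qpow-extend a 1+k≤n (ℕ.<-≤-trans (ℕ.n<1+n k) (ℕ.m≤n+m (suc k) a))

P∞-below : ∀ a k → k < a → P∞ a k ≡ one k
P∞-below a k k<a = sym (qPoch-qpow-stable a 0 k (ℕ.<-≤-trans k<a (ℕ.m≤m+n a 0)))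

qPoch-qpow-constant : ∀ a j → qPoch (qpow (suc a)) j 0 ≡ 1ℤ
qPoch-qpow-constant a j =
  trans (qPoch-qpow-stable (suc a) j 0 (s≤s z≤n)) (P∞-below (suc a) 0 (s≤s z≤n))

P∞-first : ∀ a → P∞ a ≈ 1-q^ a ⊗ P∞ (suc a)
P∞-first a = coeffwise λ k → trans (coeff (qPoch-qpow-first a k) k)
  (⊗-coeff-localʳ (1-q^ a) k λ i i≤k → qPoch-qpow-stable (suc a) k i (s≤s (ℕ.≤-trans i≤k (ℕ.m≤n+m k a))))

qPoch-⊗-P∞ : ∀ a j → qPoch (qpow a) j ⊗ P∞ (a + j) ≈ P∞ a
qPoch-⊗-P∞ a zero    = ≈-trans (*-identityˡ (P∞ (a + 0))) (≈-reflexive (cong P∞ (ℕ.+-identityʳ a)))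
qPoch-⊗-P∞ a (suc j) = begin
  qPoch (qpow a) (suc j) ⊗ P∞ (a + suc j)
    ≈⟨ ⊗-congʳ (P∞ (a + suc j)) (qPoch-qpow-last a j) ⟩
  Q ⊗ 1-q^ (a + j) ⊗ P∞ (a + suc j)
    ≈⟨ *-assoc Q (1-q^ (a + j)) (P∞ (a + suc j)) ⟩
  Q ⊗ (1-q^ (a + j) ⊗ P∞ (a + suc j))
    ≈⟨ ⊗-congˡ Q (⊗-congˡ (1-q^ (a + j)) (≈-reflexive (cong P∞ (ℕ.+-suc a j)))) ⟩
  Q ⊗ (1-q^ (a + j) ⊗ P∞ (suc (a + j)))
    ≈⟨ ⊗-congˡ Q (≈-sym (P∞-first (a + j))) ⟩
  Q ⊗ P∞ (a + j)
    ≈⟨ qPoch-⊗-P∞ a j ⟩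
  P∞ a
    ∎
  where
  open ≈-Reasoning
  Q : PS
  Q = qPoch (qpow a) j

P∞-zero : P∞ 0 ≈ zeroPS
P∞-zero = coeffwise λ k → begin
  qPoch (qpow 0) (suc k) k          ≡⟨ coeff (qPoch-qpow-first 0 k) k ⟩
  (1-q^ 0 ⊗ qPoch (qpow 1) k) k     ≡⟨ coeff (⊗-congʳ (qPoch (qpow 1) k) 1-q^0≈0) k ⟩
  (zeroPS ⊗ qPoch (qpow 1) k) k     ≡⟨ coeff (zeroˡ (qPoch (qpow 1) k)) k ⟩
  0ℤ                                ∎
  where open ≡-Reasoning

qpow-⊗-P∞-telescopes : ∀ m → qpow m ⊗ P∞ (suc m) ≈ P∞ (suc m) ⊖ P∞ m
qpow-⊗-P∞-telescopes m = begin
  qpow m ⊗ P∞ (suc m)                ≈⟨ ≈-sym (expand (qpow m) (P∞ (suc m))) ⟩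
  P∞ (suc m) ⊖ 1-q^ m ⊗ P∞ (suc m)   ≈⟨ ⊖-congˡ (P∞ (suc m)) (≈-sym (P∞-first m)) ⟩
  P∞ (suc m) ⊖ P∞ m                  ∎
  where
  open ≈-Reasoning
  expand : ∀ x y → y ⊖ (one ⊖ x) ⊗ y ≈ x ⊗ y
  expand = solve 2 (λ x y → y :- (con 1ℤ :- x) :* y := x :* y) ≈-refl

sumBelowPS : ℕ → (ℕ → PS) → PS
sumBelowPS n F k = sumBelow n (λ j → F j k)

Convergent : (ℕ → PS) → Set
Convergent F = ∀ n → q^ n ∣ F n

sumBelowPS-cong-< : ∀ n {F G : ℕ → PS} → (∀ j → j < n → F j ≈ G j) →
                    sumBelowPS n F ≈ sumBelowPS n G
sumBelowPS-cong-< n F≈G = coeffwise λ k → sumBelow-cong-< n (λ j j<n → coeff (F≈G j j<n) k)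

sumBelowPS-head : ∀ n (F : ℕ → PS) → sumBelowPS (suc n) F ≈ F 0 ⊕ sumBelowPS n (λ j → F (suc j))
sumBelowPS-head n F = coeffwise λ k → sumBelow-head n (λ j → F j k)

sumBelowPS-⊖ : ∀ n (F G : ℕ → PS) →
               sumBelowPS n (λ j → F j ⊖ G j) ≈ sumBelowPS n F ⊖ sumBelowPS n G
sumBelowPS-⊖ n F G = coeffwise λ k → sumBelow-- n (λ j → F j k) (λ j → G j k)

sumBelowPS-neg : ∀ n (F : ℕ → PS) → sumBelowPS n (λ j → neg (F j)) ≈ neg (sumBelowPS n F)
sumBelowPS-neg n F = coeffwise λ k → sumBelow-neg n (λ j → F j k)

sumBelowPS-⊗ʳ : ∀ n (F : ℕ → PS) g → sumBelowPS n F ⊗ g ≈ sumBelowPS n (λ j → F j ⊗ g)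
sumBelowPS-⊗ʳ zero    F g = zeroˡ g
sumBelowPS-⊗ʳ (suc n) F g =
  ≈-trans (⊗-distribʳ g (sumBelowPS n F) (F n)) (+-cong (sumBelowPS-⊗ʳ n F g) (≈-refl {F n ⊗ g}))

sumBelowPS-⊗ˡ : ∀ n (F : ℕ → PS) g → g ⊗ sumBelowPS n F ≈ sumBelowPS n (λ j → g ⊗ F j)
sumBelowPS-⊗ˡ n F g = begin
  g ⊗ sumBelowPS n F              ≈⟨ *-comm g (sumBelowPS n F) ⟩
  sumBelowPS n F ⊗ g              ≈⟨ sumBelowPS-⊗ʳ n F g ⟩
  sumBelowPS n (λ j → F j ⊗ g)    ≈⟨ sumBelowPS-cong-< n (λ j _ → *-comm (F j) g) ⟩
  sumBelowPS n (λ j → g ⊗ F j)    ∎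
  where open ≈-Reasoning

sumFrom0-cong : ∀ {F G : ℕ → PS} → (∀ n → F n ≈ G n) → sumFrom0 F ≈ sumFrom0 G
sumFrom0-cong F≈G = coeffwise λ k → sumBelow-cong (suc k) (λ n → coeff (F≈G n) k)

sumFrom0-⊖ : ∀ (F G : ℕ → PS) → sumFrom0 (λ n → F n ⊖ G n) ≈ sumFrom0 F ⊖ sumFrom0 G
sumFrom0-⊖ F G = coeffwise λ k → sumBelow-- (suc k) (λ n → F n k) (λ n → G n k)

sumFrom0-head : ∀ (F : ℕ → PS) → sumFrom0 F ≈ F 0 ⊕ sumFrom1 F
sumFrom0-head F = coeffwise λ k → sumBelow-head k (λ n → F n k)

sumFrom1≈sumFrom0-suc : ∀ {F : ℕ → PS} → Convergent F → sumFrom1 F ≈ sumFrom0 (λ n → F (suc n))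
sumFrom1≈sumFrom0-suc {F} conv = coeffwise λ k →
  sym (trans (cong (λ c → sumFrom1 F k ℤ.+ c) (conv (suc k) k ℕ.≤-refl)) (ℤ.+-identityʳ _))

sumFrom0-⊗ˡ : ∀ c {G : ℕ → PS} → Convergent G → c ⊗ sumFrom0 G ≈ sumFrom0 (λ m → c ⊗ G m)
sumFrom0-⊗ˡ c {G} conv = coeffwise λ k → begin
  sumBelow (suc k) (λ i → c i ℤ.* sumBelow (suc (k ∸ i)) (λ m → G m (k ∸ i)))
    ≡⟨ sumBelow-cong-< (suc k) (λ i _ → cong (c i ℤ.*_) (sym (tail-vanishes k i))) ⟩
  sumBelow (suc k) (λ i → c i ℤ.* sumBelow (suc k) (λ m → G m (k ∸ i)))
    ≡⟨ sumBelow-cong (suc k) (λ i → sym (sumBelow-*ˡ (suc k) (c i) _)) ⟩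
  sumBelow (suc k) (λ i → sumBelow (suc k) (λ m → c i ℤ.* G m (k ∸ i)))
    ≡⟨ sumBelow-comm (suc k) (suc k) _ ⟩
  sumBelow (suc k) (λ m → sumBelow (suc k) (λ i → c i ℤ.* G m (k ∸ i)))
    ∎
  where
  open ≡-Reasoning
  tail-vanishes : ∀ k i → sumBelow (suc k) (λ m → G m (k ∸ i)) ≡ sumBelow (suc (k ∸ i)) (λ m → G m (k ∸ i))
  tail-vanishes k i = sumBelow-vanishing-tail _ (s≤s (ℕ.m∸n≤m k i)) (λ m k∸i<m _ → conv m (k ∸ i) k∸i<m)

sumFrom0-triangle : ∀ (F : ℕ → ℕ → PS) → (∀ n j → q^ n ∣ F n j) →
                    sumFrom0 (λ n → sumBelowPS (suc n) (F n))
                    ≈ sumFrom0 (λ j → sumFrom0 (λ m → F (m + j) j))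
sumFrom0-triangle F conv = coeffwise λ k →
  trans (sumBelow-triangle (suc k) (λ n j → F n j k))
        (sumBelow-cong-< (suc k) λ j _ →
          sym (sumBelow-vanishing-tail _ (ℕ.m∸n≤m (suc k) j) (λ m le _ → conv (m + j) j k (k<m+j k j m le))))
  where
  k<m+j : ∀ k j m → suc k ∸ j ≤ m → k < m + j
  k<m+j k j m le =
    ℕ.≤-trans (ℕ.m≤n+m∸n (suc k) j) (ℕ.≤-trans (ℕ.+-monoʳ-≤ j le) (ℕ.≤-reflexive (ℕ.+-comm j m)))

-- Gaussian binomial coefficients

choose₂ : ℕ → ℕ
choose₂ zero    = 0
choose₂ (suc j) = choose₂ j + j

-- q-Pascal rule; for j > n the truncated n ∸ j is harmless, as then [n, j] = 0.
gauss : ℕ → ℕ → PS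
gauss n       zero    = one
gauss zero    (suc j) = zeroPS
gauss (suc n) (suc j) = qpow (n ∸ j) ⊗ gauss n j ⊕ gauss n (suc j)

gauss-above : ∀ n j → n < j → gauss n j ≈ zeroPS
gauss-above zero    (suc j) _         = ≈-refl
gauss-above (suc n) (suc j) (s≤s n<j) = begin
  qpow (n ∸ j) ⊗ gauss n j ⊕ gauss n (suc j)
    ≈⟨ +-cong (⊗-congˡ (qpow (n ∸ j)) (gauss-above n j n<j)) (gauss-above n (suc j) (ℕ.m<n⇒m<1+n n<j)) ⟩
  qpow (n ∸ j) ⊗ zeroPS ⊕ zeroPS
    ≈⟨ coeffwise (λ k → ℤ.+-identityʳ _) ⟩
  qpow (n ∸ j) ⊗ zeroPS
    ≈⟨ zeroʳ (qpow (n ∸ j)) ⟩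
  zeroPS
    ∎
  where open ≈-Reasoning

gauss-diag : ∀ n → gauss n n ≈ one
gauss-diag zero    = ≈-refl
gauss-diag (suc n) = begin
  qpow (n ∸ n) ⊗ gauss n n ⊕ gauss n (suc n)
    ≈⟨ +-cong (⊗-cong (qpow-cong (ℕ.n∸n≡0 n)) (gauss-diag n)) (gauss-above n (suc n) ℕ.≤-refl) ⟩
  qpow 0 ⊗ one ⊕ zeroPS
    ≈⟨ coeffwise (λ k → ℤ.+-identityʳ _) ⟩
  qpow 0 ⊗ one
    ≈⟨ ≈-trans (*-identityʳ (qpow 0)) qpow-zero ⟩
  one
    ∎
  where open ≈-Reasoning

qPoch-⊗-gauss : ∀ j m → qPoch (qpow 1) j ⊗ gauss (m + j) j ≈ qPoch (qpow (suc m)) j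
qPoch-⊗-gauss zero    m       = *-identityˡ one
qPoch-⊗-gauss (suc j) zero    =
  ≈-trans (⊗-congˡ (qPoch (qpow 1) (suc j)) (gauss-diag (suc j))) (*-identityʳ (qPoch (qpow 1) (suc j)))
qPoch-⊗-gauss (suc j) (suc m) = begin
  qPoch (qpow 1) (suc j) ⊗ gauss (suc (m + suc j)) (suc j)
    ≈⟨ ⊗-congˡ (qPoch (qpow 1) (suc j)) (+-cong (⊗-cong (qpow-cong m+[1+j]∸j≡1+m)
                                                         (≈-reflexive (cong (λ n → gauss n j) (ℕ.+-suc m j))))
                                                 (≈-refl {B′})) ⟩
  qPoch (qpow 1) (suc j) ⊗ (qpow (suc m) ⊗ B ⊕ B′)
    ≈⟨ ⊗-congʳ (qpow (suc m) ⊗ B ⊕ B′) (qPoch-qpow-last 1 j) ⟩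
  C ⊗ 1-q^ (suc j) ⊗ (qpow (suc m) ⊗ B ⊕ B′)
    ≈⟨ expand C (qpow (suc j)) (qpow (suc m)) B B′ ⟩
  1-q^ (suc j) ⊗ qpow (suc m) ⊗ (C ⊗ B) ⊕ C ⊗ 1-q^ (suc j) ⊗ B′
    ≈⟨ +-cong (⊗-congˡ (1-q^ (suc j) ⊗ qpow (suc m)) (qPoch-⊗-gauss j (suc m)))
              (≈-trans (⊗-congʳ B′ (≈-sym (qPoch-qpow-last 1 j))) (qPoch-⊗-gauss (suc j) m)) ⟩
  1-q^ (suc j) ⊗ qpow (suc m) ⊗ X ⊕ qPoch (qpow (suc m)) (suc j)
    ≈⟨ +-cong (≈-refl {1-q^ (suc j) ⊗ qpow (suc m) ⊗ X}) (qPoch-qpow-first (suc m) j) ⟩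
  1-q^ (suc j) ⊗ qpow (suc m) ⊗ X ⊕ 1-q^ (suc m) ⊗ X
    ≈⟨ collect X (qpow (suc j)) (qpow (suc m)) ⟩
  X ⊗ (one ⊖ qpow (suc j) ⊗ qpow (suc m))
    ≈⟨ ⊗-congˡ X (⊖-congˡ one (≈-trans (qpow-⊗-qpow (suc j) (suc m)) (qpow-cong 1+j+1+m≡2+m+j))) ⟩
  X ⊗ 1-q^ (suc (suc m) + j)
    ≈⟨ ≈-sym (qPoch-qpow-last (suc (suc m)) j) ⟩
  qPoch (qpow (suc (suc m))) (suc j)
    ∎
  where
  open ≈-Reasoning
  B B′ C X : PS
  B  = gauss (suc m + j) j
  B′ = gauss (m + suc j) (suc j)
  C  = qPoch (qpow 1) j
  X  = qPoch (qpow (suc (suc m))) j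
  m+[1+j]∸j≡1+m : m + suc j ∸ j ≡ suc m
  m+[1+j]∸j≡1+m = trans (cong (_∸ j) (ℕ.+-suc m j)) (ℕ.m+n∸n≡m (suc m) j)
  1+j+1+m≡2+m+j : suc j + suc m ≡ suc (suc m) + j
  1+j+1+m≡2+m+j = cong suc (trans (ℕ.+-suc j m) (cong suc (ℕ.+-comm j m)))
  expand : ∀ C a b B B′ → C ⊗ (one ⊖ a) ⊗ (b ⊗ B ⊕ B′)
                          ≈ (one ⊖ a) ⊗ b ⊗ (C ⊗ B) ⊕ C ⊗ (one ⊖ a) ⊗ B′
  expand = solve 5 (λ C a b B B′ → C :* (con 1ℤ :- a) :* (b :* B :+ B′)
                                   := (con 1ℤ :- a) :* b :* (C :* B) :+ C :* (con 1ℤ :- a) :* B′) ≈-refl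
  collect : ∀ X a b → (one ⊖ a) ⊗ b ⊗ X ⊕ (one ⊖ b) ⊗ X ≈ X ⊗ (one ⊖ a ⊗ b)
  collect = solve 3 (λ X a b → (con 1ℤ :- a) :* b :* X :+ (con 1ℤ :- b) :* X
                               := X :* (con 1ℤ :- a :* b)) ≈-refl

qbinomial-term : ℤ → ℕ → ℕ → ℕ → PS
qbinomial-term s a n j = const ((- s) ^ j) ⊗ (qpow (choose₂ j + a * j) ⊗ gauss n j)

qbinomial-term-pascal : ∀ s a n j → j ≤ n →
                        qbinomial-term s a (suc n) (suc j)
                        ≈ qbinomial-term s a n (suc j) ⊖ qbinomial-term s a n j ⊗ (const s ⊗ qpow (a + n))
qbinomial-term-pascal s a n j j≤n = begin
  E ⊗ (Q ⊗ (qpow (n ∸ j) ⊗ gauss n j ⊕ gauss n (suc j)))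
    ≈⟨ expand E Q (qpow (n ∸ j)) (gauss n j) (gauss n (suc j)) ⟩
  t n (suc j) ⊕ E ⊗ (Q ⊗ qpow (n ∸ j) ⊗ gauss n j)
    ≈⟨ +-cong (≈-refl {t n (suc j)}) (⊗-cong (const-neg-pow s j) (⊗-congʳ (gauss n j) exponent)) ⟩
  t n (suc j) ⊕ neg (const s) ⊗ σ ⊗ (qpow (choose₂ j + a * j) ⊗ qpow (a + n) ⊗ gauss n j)
    ≈⟨ collect (t n (suc j)) (const s) σ (qpow (choose₂ j + a * j)) (qpow (a + n)) (gauss n j) ⟩
  t n (suc j) ⊖ t n j ⊗ (const s ⊗ qpow (a + n))
    ∎
  where
  open ≈-Reasoning
  t : ℕ → ℕ → PS
  t = qbinomial-term s a
  E Q σ : PS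
  E = const ((- s) ^ suc j)
  Q = qpow (choose₂ (suc j) + a * suc j)
  σ = const ((- s) ^ j)
  exponent : Q ⊗ qpow (n ∸ j) ≈ qpow (choose₂ j + a * j) ⊗ qpow (a + n)
  exponent = begin
    Q ⊗ qpow (n ∸ j)
      ≈⟨ qpow-⊗-qpow (choose₂ (suc j) + a * suc j) (n ∸ j) ⟩
    qpow (choose₂ j + j + a * suc j + (n ∸ j))
      ≈⟨ qpow-cong (shuffle (choose₂ j) j a (n ∸ j)) ⟩
    qpow (choose₂ j + a * j + (a + (j + (n ∸ j))))
      ≈⟨ qpow-cong (cong (λ m → choose₂ j + a * j + (a + m)) (ℕ.m+[n∸m]≡n j≤n)) ⟩
    qpow (choose₂ j + a * j + (a + n))
      ≈⟨ ≈-sym (qpow-⊗-qpow (choose₂ j + a * j) (a + n)) ⟩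
    qpow (choose₂ j + a * j) ⊗ qpow (a + n)
      ∎
    where
    shuffle : ∀ c j a d → c + j + a * suc j + d ≡ c + a * j + (a + (j + d))
    shuffle = ℕ-Solver.solve-∀
  expand : ∀ E Q x B B′ → E ⊗ (Q ⊗ (x ⊗ B ⊕ B′)) ≈ E ⊗ (Q ⊗ B′) ⊕ E ⊗ (Q ⊗ x ⊗ B)
  expand = solve 5 (λ E Q x B B′ → E :* (Q :* (x :* B :+ B′)) := E :* (Q :* B′) :+ E :* (Q :* x :* B)) ≈-refl
  collect : ∀ T s σ x y B → T ⊕ neg s ⊗ σ ⊗ (x ⊗ y ⊗ B) ≈ T ⊖ σ ⊗ (x ⊗ B) ⊗ (s ⊗ y)
  collect = solve 6 (λ T s σ x y B → T :+ :- s :* σ :* (x :* y :* B) := T :- σ :* (x :* B) :* (s :* y)) ≈-refl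

q-binomial : ∀ s a n → qPoch (const s ⊗ qpow a) n ≈ sumBelowPS (suc n) (qbinomial-term s a n)
q-binomial s a zero = coeffwise λ k → sym (begin
  0ℤ ℤ.+ (one ⊗ (qpow (a * 0) ⊗ one)) k   ≡⟨ ℤ.+-identityˡ _ ⟩
  (one ⊗ (qpow (a * 0) ⊗ one)) k          ≡⟨ coeff (*-identityˡ (qpow (a * 0) ⊗ one)) k ⟩
  (qpow (a * 0) ⊗ one) k                  ≡⟨ coeff (*-identityʳ (qpow (a * 0))) k ⟩
  qpow (a * 0) k                          ≡⟨ coeff (≈-trans (qpow-cong (ℕ.*-zeroʳ a)) qpow-zero) k ⟩
  one k                                   ∎)
  where open ≡-Reasoning
q-binomial s a (suc n) = begin
  qPoch (const s ⊗ qpow a) n ⊗ (one ⊖ const s ⊗ qpow a ⊗ qpow n)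
    ≈⟨ ⊗-cong (q-binomial s a n) (⊖-congˡ one (≈-trans (*-assoc (const s) (qpow a) (qpow n))
                                                        (⊗-congˡ (const s) (qpow-⊗-qpow a n)))) ⟩
  S ⊗ (one ⊖ Y)
    ≈⟨ distribute S Y ⟩
  S ⊖ S ⊗ Y
    ≈⟨ +-cong (≈-sym last-term-vanishes) (-‿cong (sumBelowPS-⊗ʳ (suc n) (t n) Y)) ⟩
  sumBelowPS (suc (suc n)) (t n) ⊖ sumBelowPS (suc n) (λ j → t n j ⊗ Y)
    ≈⟨ +-cong (sumBelowPS-head (suc n) (t n)) (≈-refl {neg (sumBelowPS (suc n) (λ j → t n j ⊗ Y))}) ⟩
  t n 0 ⊕ sumBelowPS (suc n) (λ j → t n (suc j)) ⊖ sumBelowPS (suc n) (λ j → t n j ⊗ Y)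
    ≈⟨ reassociate (t n 0) (sumBelowPS (suc n) (λ j → t n (suc j))) (sumBelowPS (suc n) (λ j → t n j ⊗ Y)) ⟩
  t n 0 ⊕ (sumBelowPS (suc n) (λ j → t n (suc j)) ⊖ sumBelowPS (suc n) (λ j → t n j ⊗ Y))
    ≈⟨ +-cong (≈-refl {t n 0}) (≈-sym (sumBelowPS-⊖ (suc n) (λ j → t n (suc j)) (λ j → t n j ⊗ Y))) ⟩
  t n 0 ⊕ sumBelowPS (suc n) (λ j → t n (suc j) ⊖ t n j ⊗ Y)
    ≈⟨ +-cong (≈-refl {t n 0}) (sumBelowPS-cong-< (suc n) λ j j≤n →
                                  ≈-sym (qbinomial-term-pascal s a n j (ℕ.≤-pred j≤n))) ⟩
  t (suc n) 0 ⊕ sumBelowPS (suc n) (λ j → t (suc n) (suc j))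
    ≈⟨ ≈-sym (sumBelowPS-head (suc n) (t (suc n))) ⟩
  sumBelowPS (suc (suc n)) (t (suc n))
    ∎
  where
  open ≈-Reasoning
  t : ℕ → ℕ → PS
  t = qbinomial-term s a
  S Y : PS
  S = sumBelowPS (suc n) (t n)
  Y = const s ⊗ qpow (a + n)
  last-term-vanishes : sumBelowPS (suc (suc n)) (t n) ≈ S
  last-term-vanishes = coeffwise λ k →
    trans (cong (λ c → S k ℤ.+ c) (coeff vanishes k)) (ℤ.+-identityʳ (S k))
    where
    E Q : PS
    E = const ((- s) ^ suc n)
    Q = qpow (choose₂ (suc n) + a * suc n)
    vanishes : t n (suc n) ≈ zeroPS
    vanishes = begin
      E ⊗ (Q ⊗ gauss n (suc n))   ≈⟨ ⊗-congˡ E (⊗-congˡ Q (gauss-above n (suc n) ℕ.≤-refl)) ⟩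
      E ⊗ (Q ⊗ zeroPS)            ≈⟨ ⊗-congˡ E (zeroʳ Q) ⟩
      E ⊗ zeroPS                  ≈⟨ zeroʳ E ⟩
      zeroPS                      ∎
  distribute : ∀ S y → S ⊗ (one ⊖ y) ≈ S ⊖ S ⊗ y
  distribute = solve 2 (λ S y → S :* (con 1ℤ :- y) := S :- S :* y) ≈-refl
  reassociate : ∀ x y z → x ⊕ y ⊖ z ≈ x ⊕ (y ⊖ z)
  reassociate = solve 3 (λ x y z → x :+ y :- z := x :+ (y :- z)) ≈-refl

sumFrom0-qpow-P∞ : ∀ a → sumFrom0 (λ m → qpow (suc a * m) ⊗ P∞ (suc m)) ≈ qPoch (qpow 1) a
sumFrom0-qpow-P∞ zero = coeffwise λ k → begin
  sumFrom0 (λ m → qpow (1 * m) ⊗ P∞ (suc m)) k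
    ≡⟨ coeff (sumFrom0-cong telescoping) k ⟩
  sumBelow (suc k) (λ m → P∞ (suc m) k ℤ.- P∞ m k)
    ≡⟨ sumBelow-telescope (suc k) (λ m → P∞ m k) ⟩
  P∞ (suc k) k ℤ.- P∞ 0 k
    ≡⟨ cong₂ ℤ._-_ (P∞-below (suc k) k ℕ.≤-refl) (coeff P∞-zero k) ⟩
  one k ℤ.- 0ℤ
    ≡⟨ ℤ.+-identityʳ (one k) ⟩
  one k
    ∎
  where
  open ≡-Reasoning
  telescoping : ∀ m → qpow (1 * m) ⊗ P∞ (suc m) ≈ P∞ (suc m) ⊖ P∞ m
  telescoping m = ≈-trans (⊗-congʳ (P∞ (suc m)) (qpow-cong (ℕ.*-identityˡ m))) (qpow-⊗-P∞-telescopes m)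
sumFrom0-qpow-P∞ (suc a) = begin
  sumFrom0 (λ m → qpow (suc (suc a) * m) ⊗ P∞ (suc m))   ≈⟨ sumFrom0-cong split ⟩
  sumFrom0 (λ m → G m ⊖ H m)                             ≈⟨ sumFrom0-⊖ G H ⟩
  K ⊖ sumFrom0 H                                         ≈⟨ ⊖-congˡ K (sumFrom0-head H) ⟩
  K ⊖ (H 0 ⊕ sumFrom1 H)                                 ≈⟨ ⊖-congˡ K (+-cong H₀≈0 sumFrom1-H) ⟩
  K ⊖ (zeroPS ⊕ qpow (suc a) ⊗ K)                        ≈⟨ factor K (qpow (suc a)) ⟩
  K ⊗ 1-q^ (suc a)                                       ≈⟨ ⊗-congʳ (1-q^ (suc a)) (sumFrom0-qpow-P∞ a) ⟩
  qPoch (qpow 1) a ⊗ 1-q^ (suc a)                        ≈⟨ ≈-sym (qPoch-qpow-last 1 a) ⟩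
  qPoch (qpow 1) (suc a)                                 ∎
  where
  open ≈-Reasoning
  G H : ℕ → PS
  G m = qpow (suc a * m) ⊗ P∞ (suc m)
  H m = qpow (suc a * m) ⊗ P∞ m
  K : PS
  K = sumFrom0 G
  split : ∀ m → qpow (suc (suc a) * m) ⊗ P∞ (suc m) ≈ G m ⊖ H m
  split m = begin
    qpow (m + suc a * m) ⊗ P∞ (suc m)
      ≈⟨ ⊗-congʳ (P∞ (suc m)) (≈-sym (qpow-⊗-qpow m (suc a * m))) ⟩
    qpow m ⊗ qpow (suc a * m) ⊗ P∞ (suc m)
      ≈⟨ rearrange (qpow m) (qpow (suc a * m)) (P∞ (suc m)) ⟩
    qpow (suc a * m) ⊗ (qpow m ⊗ P∞ (suc m))
      ≈⟨ ⊗-congˡ (qpow (suc a * m)) (qpow-⊗-P∞-telescopes m) ⟩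
    qpow (suc a * m) ⊗ (P∞ (suc m) ⊖ P∞ m)
      ≈⟨ distribute (qpow (suc a * m)) (P∞ (suc m)) (P∞ m) ⟩
    G m ⊖ H m
      ∎
    where
    rearrange : ∀ x y z → x ⊗ y ⊗ z ≈ y ⊗ (x ⊗ z)
    rearrange = solve 3 (λ x y z → x :* y :* z := y :* (x :* z)) ≈-refl
    distribute : ∀ x y z → x ⊗ (y ⊖ z) ≈ x ⊗ y ⊖ x ⊗ z
    distribute = solve 3 (λ x y z → x :* (y :- z) := x :* y :- x :* z) ≈-refl
  H₀≈0 : H 0 ≈ zeroPS
  H₀≈0 = ≈-trans (⊗-congˡ (qpow (suc a * 0)) P∞-zero) (zeroʳ (qpow (suc a * 0)))
  sumFrom1-H : sumFrom1 H ≈ qpow (suc a) ⊗ K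
  sumFrom1-H = begin
    sumFrom1 H
      ≈⟨ sumFrom1≈sumFrom0-suc (λ m → q^∣-⊗ˡ (P∞ m) (q^∣qpow-multiple a m)) ⟩
    sumFrom0 (λ m → H (suc m))
      ≈⟨ sumFrom0-cong shift ⟩
    sumFrom0 (λ m → qpow (suc a) ⊗ G m)
      ≈⟨ ≈-sym (sumFrom0-⊗ˡ (qpow (suc a)) (λ m → q^∣-⊗ˡ (P∞ (suc m)) (q^∣qpow-multiple a m))) ⟩
    qpow (suc a) ⊗ K
      ∎
    where
    shift : ∀ m → H (suc m) ≈ qpow (suc a) ⊗ G m
    shift m = begin
      qpow (suc a * suc m) ⊗ P∞ (suc m)
        ≈⟨ ⊗-congʳ (P∞ (suc m)) (qpow-cong (ℕ.*-suc (suc a) m)) ⟩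
      qpow (suc a + suc a * m) ⊗ P∞ (suc m)
        ≈⟨ ⊗-congʳ (P∞ (suc m)) (≈-sym (qpow-⊗-qpow (suc a) (suc a * m))) ⟩
      qpow (suc a) ⊗ qpow (suc a * m) ⊗ P∞ (suc m)
        ≈⟨ *-assoc (qpow (suc a)) (qpow (suc a * m)) (P∞ (suc m)) ⟩
      qpow (suc a) ⊗ G m
        ∎
  factor : ∀ x y → x ⊖ (zeroPS ⊕ y ⊗ x) ≈ x ⊗ (one ⊖ y)
  factor = solve 2 (λ x y → x :- (con 0ℤ :+ y :* x) := x :* (con 1ℤ :- y)) ≈-refl

gauss-P∞-term : ℕ → ℕ → PS
gauss-P∞-term j m = qpow (suc j * m) ⊗ (gauss (m + j) j ⊗ P∞ (suc m + j))

gauss-P∞-term-convergent : ∀ j → Convergent (gauss-P∞-term j)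
gauss-P∞-term-convergent j m = q^∣-⊗ˡ (gauss (m + j) j ⊗ P∞ (suc m + j)) (q^∣qpow-multiple j m)

sumFrom0-gauss-P∞-term : ∀ j → sumFrom0 (gauss-P∞-term j) ≈ one
sumFrom0-gauss-P∞-term j = ⊗-cancelˡ C (qPoch-qpow-constant 0 j) (begin
  C ⊗ sumFrom0 (gauss-P∞-term j)                 ≈⟨ sumFrom0-⊗ˡ C (gauss-P∞-term-convergent j) ⟩
  sumFrom0 (λ m → C ⊗ gauss-P∞-term j m)         ≈⟨ sumFrom0-cong absorb ⟩
  sumFrom0 (λ m → qpow (suc j * m) ⊗ P∞ (suc m)) ≈⟨ sumFrom0-qpow-P∞ j ⟩
  C                                              ≈⟨ ≈-sym (*-identityʳ C) ⟩
  C ⊗ one                                        ∎)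
  where
  open ≈-Reasoning
  C : PS
  C = qPoch (qpow 1) j
  absorb : ∀ m → C ⊗ gauss-P∞-term j m ≈ qpow (suc j * m) ⊗ P∞ (suc m)
  absorb m = begin
    C ⊗ (Q ⊗ (gauss (m + j) j ⊗ P∞ (suc m + j)))
      ≈⟨ rearrange C Q (gauss (m + j) j) (P∞ (suc m + j)) ⟩
    Q ⊗ (C ⊗ gauss (m + j) j ⊗ P∞ (suc m + j))
      ≈⟨ ⊗-congˡ Q (⊗-congʳ (P∞ (suc m + j)) (qPoch-⊗-gauss j m)) ⟩
    Q ⊗ (qPoch (qpow (suc m)) j ⊗ P∞ (suc m + j))
      ≈⟨ ⊗-congˡ Q (qPoch-⊗-P∞ (suc m) j) ⟩
    Q ⊗ P∞ (suc m)
      ∎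
    where
    Q : PS
    Q = qpow (suc j * m)
    rearrange : ∀ C Q B P → C ⊗ (Q ⊗ (B ⊗ P)) ≈ Q ⊗ (C ⊗ B ⊗ P)
    rearrange = solve 4 (λ C Q B P → C :* (Q :* (B :* P)) := Q :* (C :* B :* P)) ≈-refl

-- j(3j - 1)/2 and j(3j + 1)/2
pent⁻ pent⁺ : ℕ → ℕ
pent⁻ j = choose₂ j + j * j
pent⁺ j = pent⁻ j + j

sumFrom0-qPoch-scaled : ∀ s → sumFrom0 (λ n → qpow n ⊗ P∞ (suc n) ⊗ qPoch (const s ⊗ qpow n) n)
                              ≈ sumFrom0 (λ j → const ((- s) ^ j) ⊗ qpow (pent⁺ j))
sumFrom0-qPoch-scaled s = begin
  sumFrom0 (λ n → qpow n ⊗ P∞ (suc n) ⊗ qPoch (const s ⊗ qpow n) n)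
    ≈⟨ sumFrom0-cong (λ n → ≈-trans (⊗-congˡ (qpow n ⊗ P∞ (suc n)) (q-binomial s n n))
                                    (sumBelowPS-⊗ˡ (suc n) (qbinomial-term s n n) (qpow n ⊗ P∞ (suc n)))) ⟩
  sumFrom0 (λ n → sumBelowPS (suc n) (F n))
    ≈⟨ sumFrom0-triangle F (λ n j → q^∣-⊗ˡ (qbinomial-term s n n j) (q^∣-⊗ˡ (P∞ (suc n)) (q^∣qpow n))) ⟩
  sumFrom0 (λ j → sumFrom0 (λ m → F (m + j) j))
    ≈⟨ sumFrom0-cong (λ j → sumFrom0-cong (regroup j)) ⟩
  sumFrom0 (λ j → sumFrom0 (λ m → c j ⊗ gauss-P∞-term j m))
    ≈⟨ sumFrom0-cong (λ j → ≈-sym (sumFrom0-⊗ˡ (c j) (gauss-P∞-term-convergent j))) ⟩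
  sumFrom0 (λ j → c j ⊗ sumFrom0 (gauss-P∞-term j))
    ≈⟨ sumFrom0-cong (λ j → ≈-trans (⊗-congˡ (c j) (sumFrom0-gauss-P∞-term j)) (*-identityʳ (c j))) ⟩
  sumFrom0 c
    ∎
  where
  open ≈-Reasoning
  F : ℕ → ℕ → PS
  F n j = qpow n ⊗ P∞ (suc n) ⊗ qbinomial-term s n n j
  c : ℕ → PS
  c j = const ((- s) ^ j) ⊗ qpow (pent⁺ j)
  regroup : ∀ j m → F (m + j) j ≈ c j ⊗ gauss-P∞-term j m
  regroup j m = begin
    qpow n ⊗ P∞ (suc n) ⊗ (σ ⊗ (qpow (choose₂ j + n * j) ⊗ B))
      ≈⟨ rearrange (qpow n) (P∞ (suc n)) σ (qpow (choose₂ j + n * j)) B ⟩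
    σ ⊗ (qpow n ⊗ qpow (choose₂ j + n * j)) ⊗ (B ⊗ P∞ (suc n))
      ≈⟨ ⊗-congʳ (B ⊗ P∞ (suc n)) (⊗-congˡ σ exponent) ⟩
    σ ⊗ (qpow (pent⁺ j) ⊗ qpow (suc j * m)) ⊗ (B ⊗ P∞ (suc n))
      ≈⟨ reassociate σ (qpow (pent⁺ j)) (qpow (suc j * m)) (B ⊗ P∞ (suc n)) ⟩
    c j ⊗ gauss-P∞-term j m
      ∎
    where
    n : ℕ
    n = m + j
    σ B : PS
    σ = const ((- s) ^ j)
    B = gauss n j
    exponent : qpow n ⊗ qpow (choose₂ j + n * j) ≈ qpow (pent⁺ j) ⊗ qpow (suc j * m)
    exponent = begin
      qpow n ⊗ qpow (choose₂ j + n * j)      ≈⟨ qpow-⊗-qpow n (choose₂ j + n * j) ⟩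
      qpow (m + j + (choose₂ j + n * j))     ≈⟨ qpow-cong (shuffle (choose₂ j) m j) ⟩
      qpow (pent⁺ j + suc j * m)             ≈⟨ ≈-sym (qpow-⊗-qpow (pent⁺ j) (suc j * m)) ⟩
      qpow (pent⁺ j) ⊗ qpow (suc j * m)      ∎
      where
      shuffle : ∀ c m j → m + j + (c + (m + j) * j) ≡ c + j * j + j + suc j * m
      shuffle = ℕ-Solver.solve-∀
    rearrange : ∀ x P σ y B → x ⊗ P ⊗ (σ ⊗ (y ⊗ B)) ≈ σ ⊗ (x ⊗ y) ⊗ (B ⊗ P)
    rearrange = solve 5 (λ x P σ y B → x :* P :* (σ :* (y :* B)) := σ :* (x :* y) :* (B :* P)) ≈-refl
    reassociate : ∀ σ x y R → σ ⊗ (x ⊗ y) ⊗ R ≈ σ ⊗ x ⊗ (y ⊗ R)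
    reassociate = solve 4 (λ σ x y R → σ :* (x :* y) :* R := σ :* x :* (y :* R)) ≈-refl

-- Euler's pentagonal number theorem via Shanks' identity

sgn : ℕ → PS
sgn k = const (-1ℤ ^ k)

sgn-suc : ∀ k → sgn (suc k) ≈ neg one ⊗ sgn k
sgn-suc = const-neg-pow 1ℤ

shanks-term : ℕ → ℕ → PS
shanks-term N k = sgn k ⊗ (qpow (N * k + (choose₂ k + k)) ⊗ qPoch (qpow (suc k)) (N ∸ k))

shanks-term-first : ∀ N → shanks-term N 0 ≈ qPoch (qpow 1) N
shanks-term-first N = begin
  one ⊗ (qpow (N * 0 + 0) ⊗ qPoch (qpow 1) N)
    ≈⟨ *-identityˡ (qpow (N * 0 + 0) ⊗ qPoch (qpow 1) N) ⟩
  qpow (N * 0 + 0) ⊗ qPoch (qpow 1) N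
    ≈⟨ ⊗-congʳ (qPoch (qpow 1) N) (≈-trans (qpow-cong N*0+0≡0) qpow-zero) ⟩
  one ⊗ qPoch (qpow 1) N
    ≈⟨ *-identityˡ (qPoch (qpow 1) N) ⟩
  qPoch (qpow 1) N
    ∎
  where
  open ≈-Reasoning
  N*0+0≡0 : N * 0 + 0 ≡ 0
  N*0+0≡0 = trans (ℕ.+-identityʳ (N * 0)) (ℕ.*-zeroʳ N)

shanks-term-later : ∀ N i → shanks-term N (suc i) N ≡ 0ℤ
shanks-term-later N i = q^∣-⊗ʳ (sgn (suc i)) e∣term N ℕ.≤-refl
  where
  e : ℕ
  e = N * suc i + (choose₂ (suc i) + suc i)
  N<e : suc N ≤ e
  N<e = ℕ.≤-trans (ℕ.≤-reflexive (ℕ.+-comm 1 N))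
                  (ℕ.+-mono-≤ (ℕ.m≤m*n N (suc i)) (ℕ.≤-trans (s≤s z≤n) (ℕ.m≤n+m (suc i) (choose₂ (suc i)))))
  e∣term : q^ suc N ∣ qpow e ⊗ qPoch (qpow (suc (suc i))) (N ∸ suc i)
  e∣term = q^∣-⊗ˡ (qPoch (qpow (suc (suc i))) (N ∸ suc i)) (q^∣-weaken N<e (q^∣qpow e))

shanks-term-suc : ∀ N k → k ≤ N →
                  shanks-term (suc N) k
                  ≈ shanks-term N k ⊖ 1-q^ k ⊗ shanks-term N k ⊖ qpow (k + suc N) ⊗ shanks-term N k
shanks-term-suc N k k≤N = begin
  sgn k ⊗ (qpow (suc N * k + T) ⊗ qPoch (qpow (suc k)) (suc N ∸ k))
    ≈⟨ ⊗-congˡ (sgn k) (⊗-cong exponent last-factor) ⟩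
  sgn k ⊗ (qpow k ⊗ qpow (N * k + T) ⊗ (X ⊗ 1-q^ (suc N)))
    ≈⟨ split (sgn k) (qpow k) (qpow (N * k + T)) X (qpow (suc N)) ⟩
  Y ⊖ 1-q^ k ⊗ Y ⊖ qpow k ⊗ qpow (suc N) ⊗ Y
    ≈⟨ ⊖-congˡ (Y ⊖ 1-q^ k ⊗ Y) (⊗-congʳ Y (qpow-⊗-qpow k (suc N))) ⟩
  Y ⊖ 1-q^ k ⊗ Y ⊖ qpow (k + suc N) ⊗ Y
    ∎
  where
  open ≈-Reasoning
  T : ℕ
  T = choose₂ k + k
  X Y : PS
  X = qPoch (qpow (suc k)) (N ∸ k)
  Y = shanks-term N k
  exponent : qpow (suc N * k + T) ≈ qpow k ⊗ qpow (N * k + T)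
  exponent = ≈-trans (qpow-cong (ℕ.+-assoc k (N * k) T)) (≈-sym (qpow-⊗-qpow k (N * k + T)))
  last-factor : qPoch (qpow (suc k)) (suc N ∸ k) ≈ X ⊗ 1-q^ (suc N)
  last-factor = begin
    qPoch (qpow (suc k)) (suc N ∸ k)
      ≈⟨ ≈-reflexive (cong (qPoch (qpow (suc k))) (ℕ.+-∸-assoc 1 k≤N)) ⟩
    qPoch (qpow (suc k)) (suc (N ∸ k))
      ≈⟨ qPoch-qpow-last (suc k) (N ∸ k) ⟩
    X ⊗ 1-q^ (suc k + (N ∸ k))
      ≈⟨ ⊗-congˡ X (≈-reflexive (cong (λ n → 1-q^ suc n) (ℕ.m+[n∸m]≡n k≤N))) ⟩
    X ⊗ 1-q^ (suc N)
      ∎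
  split : ∀ σ a b X c → σ ⊗ (a ⊗ b ⊗ (X ⊗ (one ⊖ c)))
                        ≈ σ ⊗ (b ⊗ X) ⊖ (one ⊖ a) ⊗ (σ ⊗ (b ⊗ X)) ⊖ a ⊗ c ⊗ (σ ⊗ (b ⊗ X))
  split = solve 5 (λ σ a b X c → σ :* (a :* b :* (X :* (con 1ℤ :- c)))
                                 := σ :* (b :* X) :- (con 1ℤ :- a) :* (σ :* (b :* X)) :- a :* c :* (σ :* (b :* X)))
                  ≈-refl

shanks-term-shift : ∀ N k → k < N →
                    1-q^ (suc k) ⊗ shanks-term N (suc k) ≈ neg (qpow (k + suc N) ⊗ shanks-term N k)
shanks-term-shift N k k<N = begin
  1-q^ (suc k) ⊗ (sgn (suc k) ⊗ (qpow (N * suc k + (T + suc k)) ⊗ X′))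
    ≈⟨ ⊗-congˡ (1-q^ (suc k)) (⊗-cong (sgn-suc k) (⊗-congʳ X′ exponent)) ⟩
  1-q^ (suc k) ⊗ (neg one ⊗ sgn k ⊗ (qpow (N * k + T) ⊗ qpow (k + suc N) ⊗ X′))
    ≈⟨ rearrange (1-q^ (suc k)) (sgn k) (qpow (N * k + T)) (qpow (k + suc N)) X′ ⟩
  neg (qpow (k + suc N) ⊗ (sgn k ⊗ (qpow (N * k + T) ⊗ (1-q^ (suc k) ⊗ X′))))
    ≈⟨ -‿cong (⊗-congˡ (qpow (k + suc N)) (⊗-congˡ (sgn k) (⊗-congˡ (qpow (N * k + T)) absorb))) ⟩
  neg (qpow (k + suc N) ⊗ shanks-term N k)
    ∎
  where
  open ≈-Reasoning
  T : ℕ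
  T = choose₂ k + k
  X′ : PS
  X′ = qPoch (qpow (suc (suc k))) (N ∸ suc k)
  exponent : qpow (N * suc k + (T + suc k)) ≈ qpow (N * k + T) ⊗ qpow (k + suc N)
  exponent = ≈-trans (qpow-cong (shuffle N k T)) (≈-sym (qpow-⊗-qpow (N * k + T) (k + suc N)))
    where
    shuffle : ∀ N k T → N * suc k + (T + suc k) ≡ N * k + T + (k + suc N)
    shuffle = ℕ-Solver.solve-∀
  absorb : 1-q^ (suc k) ⊗ X′ ≈ qPoch (qpow (suc k)) (N ∸ k)
  absorb = ≈-trans (≈-sym (qPoch-qpow-first (suc k) (N ∸ suc k)))
                   (≈-reflexive (cong (qPoch (qpow (suc k))) (sym (ℕ.+-∸-assoc 1 k<N))))
  rearrange : ∀ f σ x y X → f ⊗ (neg one ⊗ σ ⊗ (x ⊗ y ⊗ X)) ≈ neg (y ⊗ (σ ⊗ (x ⊗ (f ⊗ X))))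
  rearrange = solve 5 (λ f σ x y X → f :* (:- con 1ℤ :* σ :* (x :* y :* X)) := :- (y :* (σ :* (x :* (f :* X)))))
                      ≈-refl

-- Summed over k ≤ N, the middle terms of shanks-term-suc cancel the last ones by shanks-term-shift.
shanks-sum-suc : ∀ N → sumBelowPS (suc N) (shanks-term (suc N))
                       ≈ sumBelowPS (suc N) (shanks-term N) ⊖ qpow (N + suc N) ⊗ shanks-term N N
shanks-sum-suc N = begin
  sumBelowPS (suc N) (shanks-term (suc N))
    ≈⟨ sumBelowPS-cong-< (suc N) (λ k k≤N → shanks-term-suc N k (ℕ.≤-pred k≤N)) ⟩
  sumBelowPS (suc N) (λ k → Y k ⊖ U k ⊖ V k)
    ≈⟨ ≈-trans (sumBelowPS-⊖ (suc N) (λ k → Y k ⊖ U k) V)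
               (+-cong (sumBelowPS-⊖ (suc N) Y U) (≈-refl {neg (ΣV ⊕ V N)})) ⟩
  sumBelowPS (suc N) Y ⊖ sumBelowPS (suc N) U ⊖ (ΣV ⊕ V N)
    ≈⟨ +-cong (⊖-congˡ (sumBelowPS (suc N) Y) ΣU≈-ΣV) (≈-refl {neg (ΣV ⊕ V N)}) ⟩
  sumBelowPS (suc N) Y ⊖ (zeroPS ⊕ neg ΣV) ⊖ (ΣV ⊕ V N)
    ≈⟨ cancel (sumBelowPS (suc N) Y) ΣV (V N) ⟩
  sumBelowPS (suc N) Y ⊖ V N
    ∎
  where
  open ≈-Reasoning
  Y U V : ℕ → PS
  Y = shanks-term N
  U k = 1-q^ k ⊗ Y k
  V k = qpow (k + suc N) ⊗ Y k
  ΣV : PS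
  ΣV = sumBelowPS N V
  ΣU≈-ΣV : sumBelowPS (suc N) U ≈ zeroPS ⊕ neg ΣV
  ΣU≈-ΣV = begin
    sumBelowPS (suc N) U
      ≈⟨ sumBelowPS-head N U ⟩
    U 0 ⊕ sumBelowPS N (λ k → U (suc k))
      ≈⟨ +-cong (≈-trans (⊗-congʳ (Y 0) 1-q^0≈0) (zeroˡ (Y 0))) (sumBelowPS-cong-< N (shanks-term-shift N)) ⟩
    zeroPS ⊕ sumBelowPS N (λ k → neg (V k))
      ≈⟨ +-cong (≈-refl {zeroPS}) (sumBelowPS-neg N V) ⟩
    zeroPS ⊕ neg ΣV
      ∎
  cancel : ∀ A S v → A ⊖ (zeroPS ⊕ neg S) ⊖ (S ⊕ v) ≈ A ⊖ v
  cancel = solve 3 (λ A S v → A :- (con 0ℤ :+ :- S) :- (S :+ v) := A :- v) ≈-refl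

shanks : ∀ N → sumBelowPS (suc N) (shanks-term N)
               ≈ sumBelowPS (suc N) (λ j → sgn j ⊗ qpow (pent⁺ j))
                 ⊕ sumBelowPS N (λ i → sgn (suc i) ⊗ qpow (pent⁻ (suc i)))
shanks zero = coeffwise λ k →
  trans (cong (ℤ._+_ 0ℤ) (coeff (⊗-congˡ one (*-identityʳ (qpow 0))) k)) (sym (ℤ.+-identityʳ _))
shanks (suc N) = begin
  sumBelowPS (suc N) (shanks-term (suc N)) ⊕ shanks-term (suc N) (suc N)
    ≈⟨ +-cong (shanks-sum-suc N) last-term ⟩
  sumBelowPS (suc N) (shanks-term N) ⊖ V ⊕ L
    ≈⟨ +-cong (+-cong (shanks N) (≈-refl {neg V})) (≈-refl {L}) ⟩
  A ⊕ B ⊖ V ⊕ L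
    ≈⟨ regroup A B V L ⟩
  A ⊕ L ⊕ (B ⊕ neg V)
    ≈⟨ +-cong (≈-refl {A ⊕ L}) (+-cong (≈-refl {B}) -V≈new-term) ⟩
  A ⊕ L ⊕ (B ⊕ sgn (suc N) ⊗ qpow (pent⁻ (suc N)))
    ∎
  where
  open ≈-Reasoning
  A B V L : PS
  A = sumBelowPS (suc N) (λ j → sgn j ⊗ qpow (pent⁺ j))
  B = sumBelowPS N (λ i → sgn (suc i) ⊗ qpow (pent⁻ (suc i)))
  V = qpow (N + suc N) ⊗ shanks-term N N
  L = sgn (suc N) ⊗ qpow (pent⁺ (suc N))
  no-factors : ∀ a → qPoch (qpow a) (N ∸ N) ≈ one
  no-factors a = ≈-reflexive (cong (qPoch (qpow a)) (ℕ.n∸n≡0 N))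
  last-term : shanks-term (suc N) (suc N) ≈ L
  last-term = ⊗-congˡ (sgn (suc N)) (begin
    qpow (suc N * suc N + (choose₂ (suc N) + suc N)) ⊗ qPoch (qpow (suc (suc N))) (N ∸ N)
      ≈⟨ ⊗-cong (qpow-cong (shuffle N (choose₂ N))) (no-factors (suc (suc N))) ⟩
    qpow (pent⁺ (suc N)) ⊗ one
      ≈⟨ *-identityʳ (qpow (pent⁺ (suc N))) ⟩
    qpow (pent⁺ (suc N))
      ∎)
    where
    shuffle : ∀ N c → suc N * suc N + (c + N + suc N) ≡ c + N + suc N * suc N + suc N
    shuffle = ℕ-Solver.solve-∀
  -V≈new-term : neg V ≈ sgn (suc N) ⊗ qpow (pent⁻ (suc N))
  -V≈new-term = begin
    neg (qpow (N + suc N) ⊗ (sgn N ⊗ (qpow e ⊗ qPoch (qpow (suc N)) (N ∸ N))))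
      ≈⟨ rearrange (qpow (N + suc N)) (sgn N) (qpow e) (qPoch (qpow (suc N)) (N ∸ N)) ⟩
    neg one ⊗ sgn N ⊗ (qpow (N + suc N) ⊗ qpow e ⊗ qPoch (qpow (suc N)) (N ∸ N))
      ≈⟨ ⊗-cong (≈-sym (sgn-suc N))
                (⊗-cong (≈-trans (qpow-⊗-qpow (N + suc N) e) (qpow-cong (shuffle N (choose₂ N))))
                        (no-factors (suc N))) ⟩
    sgn (suc N) ⊗ (qpow (pent⁻ (suc N)) ⊗ one)
      ≈⟨ ⊗-congˡ (sgn (suc N)) (*-identityʳ (qpow (pent⁻ (suc N)))) ⟩
    sgn (suc N) ⊗ qpow (pent⁻ (suc N))
      ∎
    where
    e : ℕ
    e = N * N + (choose₂ N + N)
    shuffle : ∀ N c → N + suc N + (N * N + (c + N)) ≡ c + N + suc N * suc N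
    shuffle = ℕ-Solver.solve-∀
    rearrange : ∀ a σ b x → neg (a ⊗ (σ ⊗ (b ⊗ x))) ≈ neg one ⊗ σ ⊗ (a ⊗ b ⊗ x)
    rearrange = solve 4 (λ a σ b x → :- (a :* (σ :* (b :* x))) := :- con 1ℤ :* σ :* (a :* b :* x)) ≈-refl
  regroup : ∀ A B V L → A ⊕ B ⊖ V ⊕ L ≈ A ⊕ L ⊕ (B ⊕ neg V)
  regroup = solve 4 (λ A B V L → A :+ B :- V :+ L := A :+ L :+ (B :+ :- V)) ≈-refl

euler : P∞ 1 ≈ sumFrom0 (λ j → sgn j ⊗ qpow (pent⁺ j)) ⊕ sumFrom1 (λ i → sgn i ⊗ qpow (pent⁻ i))
euler = coeffwise λ k → begin
  P∞ 1 k
    ≡⟨ sym (qPoch-qpow-stable 1 k k ℕ.≤-refl) ⟩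
  qPoch (qpow 1) k k
    ≡⟨ sym (coeff (shanks-term-first k) k) ⟩
  shanks-term k 0 k
    ≡⟨ sym (ℤ.+-identityʳ _) ⟩
  shanks-term k 0 k ℤ.+ 0ℤ
    ≡⟨ cong (ℤ._+_ (shanks-term k 0 k)) (sym (sumBelow-zeros k (λ i _ → shanks-term-later k i))) ⟩
  shanks-term k 0 k ℤ.+ sumBelow k (λ i → shanks-term k (suc i) k)
    ≡⟨ sym (sumBelow-head k (λ j → shanks-term k j k)) ⟩
  sumBelowPS (suc k) (shanks-term k) k
    ≡⟨ coeff (shanks k) k ⟩
  (sumFrom0 (λ j → sgn j ⊗ qpow (pent⁺ j)) ⊕ sumFrom1 (λ i → sgn i ⊗ qpow (pent⁻ i))) k
    ∎
  where open ≡-Reasoning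

choose₂-double : ∀ j → choose₂ j * 2 + j ≡ j * j
choose₂-double zero    = refl
choose₂-double (suc j) = begin
  (choose₂ j + j) * 2 + suc j        ≡⟨ shuffle (choose₂ j) j ⟩
  choose₂ j * 2 + j + (2 * j + 1)    ≡⟨ cong (_+ (2 * j + 1)) (choose₂-double j) ⟩
  j * j + (2 * j + 1)                ≡⟨ square j ⟩
  suc j * suc j                      ∎
  where
  open ≡-Reasoning
  shuffle : ∀ c j → (c + j) * 2 + suc j ≡ c * 2 + j + (2 * j + 1)
  shuffle = ℕ-Solver.solve-∀
  square : ∀ j → j * j + (2 * j + 1) ≡ suc j * suc j
  square = ℕ-Solver.solve-∀

pent⁻-double : ∀ j → pent⁻ j * 2 + j ≡ 3 * (j * j)
pent⁻-double j = begin
  (choose₂ j + j * j) * 2 + j        ≡⟨ shuffle (choose₂ j) j ⟩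
  choose₂ j * 2 + j + 2 * (j * j)    ≡⟨ cong (_+ 2 * (j * j)) (choose₂-double j) ⟩
  j * j + 2 * (j * j)                ≡⟨ triple (j * j) ⟩
  3 * (j * j)                        ∎
  where
  open ≡-Reasoning
  shuffle : ∀ c j → (c + j * j) * 2 + j ≡ c * 2 + j + 2 * (j * j)
  shuffle = ℕ-Solver.solve-∀
  triple : ∀ s → s + 2 * s ≡ 3 * s
  triple = ℕ-Solver.solve-∀

pent⁺-double : ∀ j → pent⁺ j * 2 ≡ 3 * (j * j) + j
pent⁺-double j = trans (shuffle (pent⁻ j) j) (cong (_+ j) (pent⁻-double j))
  where
  shuffle : ∀ p j → (p + j) * 2 ≡ p * 2 + j + j
  shuffle = ℕ-Solver.solve-∀

pent≡pent⁻ : ∀ n → pent n ≡ pent⁻ n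
pent≡pent⁻ n = trans (cong (_/ 2) (sym (double n))) (m*n/n≡m (pent⁻ n) 2)
  where
  double : ∀ n → pent⁻ n * 2 ≡ n * (3 * n ∸ 1)
  double zero    = refl
  double (suc i) = ℕ.+-cancelʳ-≡ (suc i) _ _ (begin
    pent⁻ (suc i) * 2 + suc i                  ≡⟨ pent⁻-double (suc i) ⟩
    3 * (suc i * suc i)                        ≡⟨ expand i ⟩
    suc i * (suc (2 + 3 * i) ∸ 1) + suc i      ≡⟨ cong (λ m → suc i * (m ∸ 1) + suc i) (sym (triple-suc i)) ⟩
    suc i * (3 * suc i ∸ 1) + suc i            ∎)
    where
    open ≡-Reasoning
    expand : ∀ i → 3 * (suc i * suc i) ≡ suc i * (2 + 3 * i) + suc i
    expand = ℕ-Solver.solve-∀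
    triple-suc : ∀ i → 3 * suc i ≡ suc (2 + 3 * i)
    triple-suc = ℕ-Solver.solve-∀

pent⁺-odd : ∀ n → pent⁺ (suc (2 * n)) ≡ 6 * n * n + 7 * n + 2
pent⁺-odd n = ℕ.*-cancelʳ-≡ _ _ 2 (trans (pent⁺-double (suc (2 * n))) (expand n))
  where
  expand : ∀ n → 3 * (suc (2 * n) * suc (2 * n)) + suc (2 * n) ≡ (6 * n * n + 7 * n + 2) * 2
  expand = ℕ-Solver.solve-∀

-1^even : ∀ n → -1ℤ ^ (2 * n) ≡ 1ℤ
-1^even n = trans (sym (ℤ.^-*-assoc -1ℤ 2 n)) (ℤ.^-zeroˡ n)

sumFrom0-minus-alternating : ∀ (e : ℕ → ℕ) → (∀ j → j ≤ e j) →
                             sumFrom0 (λ j → qpow (e j)) ⊖ sumFrom0 (λ j → sgn j ⊗ qpow (e j))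
                             ≈ (+ 2) · sumFrom0 (λ n → qpow (e (suc (2 * n))))
sumFrom0-minus-alternating e j≤e = coeffwise λ k → begin
  sumFrom0 (λ j → qpow (e j)) k ℤ.- sumFrom0 (λ j → sgn j ⊗ qpow (e j)) k
    ≡⟨ sym (sumBelow-- (suc k) (λ j → qpow (e j) k) (λ j → (sgn j ⊗ qpow (e j)) k)) ⟩
  sumBelow (suc k) (λ j → qpow (e j) k ℤ.- (sgn j ⊗ qpow (e j)) k)
    ≡⟨ sumBelow-cong (suc k) (λ j → trans (cong (λ c → qpow (e j) k ℤ.- c) (const-⊗ (-1ℤ ^ j) (qpow (e j)) k))
                                          (factor (-1ℤ ^ j) (qpow (e j) k))) ⟩
  sumBelow (suc k) (h k)
    ≡⟨ sym (sumBelow-vanishing-tail (h k) (ℕ.m≤n*m (suc k) 2) (λ j k<j _ → beyond k j k<j)) ⟩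
  sumBelow (2 * suc k) (h k)
    ≡⟨ sumBelow-even-odd (suc k) (h k) ⟩
  sumBelow (suc k) (λ n → h k (2 * n)) ℤ.+ sumBelow (suc k) (λ n → h k (suc (2 * n)))
    ≡⟨ cong₂ ℤ._+_ (sumBelow-zeros (suc k) (λ n _ → even k n)) (sumBelow-cong (suc k) (odd k)) ⟩
  0ℤ ℤ.+ sumBelow (suc k) (λ n → + 2 ℤ.* qpow (e (suc (2 * n))) k)
    ≡⟨ trans (ℤ.+-identityˡ _) (sumBelow-*ˡ (suc k) (+ 2) (λ n → qpow (e (suc (2 * n))) k)) ⟩
  + 2 ℤ.* sumFrom0 (λ n → qpow (e (suc (2 * n)))) k
    ∎
  where
  open ≡-Reasoning
  h : ℕ → ℕ → ℤ
  h k j = (1ℤ ℤ.- -1ℤ ^ j) ℤ.* qpow (e j) k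
  factor : ∀ a x → x ℤ.- a ℤ.* x ≡ (1ℤ ℤ.- a) ℤ.* x
  factor = ℤ-Solver.solve-∀
  beyond : ∀ k j → k < j → h k j ≡ 0ℤ
  beyond k j k<j = trans (cong ((1ℤ ℤ.- -1ℤ ^ j) ℤ.*_) (qpow-off (ℕ.>⇒≢ (ℕ.<-≤-trans k<j (j≤e j)))))
                         (ℤ.*-zeroʳ (1ℤ ℤ.- -1ℤ ^ j))
  even : ∀ k n → h k (2 * n) ≡ 0ℤ
  even k n = trans (cong (λ t → (1ℤ ℤ.- t) ℤ.* qpow (e (2 * n)) k) (-1^even n)) (ℤ.*-zeroˡ (qpow (e (2 * n)) k))
  odd : ∀ k n → h k (suc (2 * n)) ≡ + 2 ℤ.* qpow (e (suc (2 * n))) k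
  odd k n = cong (λ t → (1ℤ ℤ.- -1ℤ ℤ.* t) ℤ.* qpow (e (suc (2 * n))) k) (-1^even n)

sumFrom1-qPoch-scaled : ∀ s {z : ℕ → PS} → (∀ n → z n ≈ const s ⊗ qpow n) →
                        sumFrom1 (λ n → qpow n ⊗ P∞ (suc n) ⊗ qPoch (z n) n)
                        ≈ sumFrom0 (λ j → const ((- s) ^ j) ⊗ qpow (pent⁺ j)) ⊖ P∞ 1
sumFrom1-qPoch-scaled s {z} z≈sqⁿ = begin
  sumFrom1 F
    ≈⟨ ≈-sym (drop-head (F 0) (sumFrom1 F)) ⟩
  F 0 ⊕ sumFrom1 F ⊖ F 0
    ≈⟨ +-cong (≈-sym (sumFrom0-head F)) (-‿cong F₀≈P∞1) ⟩
  sumFrom0 F ⊖ P∞ 1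
    ≈⟨ +-cong (sumFrom0-cong (λ n → ⊗-congˡ (qpow n ⊗ P∞ (suc n)) (qPoch-cong n (z≈sqⁿ n))))
              (≈-refl {neg (P∞ 1)}) ⟩
  sumFrom0 (λ n → qpow n ⊗ P∞ (suc n) ⊗ qPoch (const s ⊗ qpow n) n) ⊖ P∞ 1
    ≈⟨ +-cong (sumFrom0-qPoch-scaled s) (≈-refl {neg (P∞ 1)}) ⟩
  sumFrom0 (λ j → const ((- s) ^ j) ⊗ qpow (pent⁺ j)) ⊖ P∞ 1
    ∎
  where
  open ≈-Reasoning
  F : ℕ → PS
  F n = qpow n ⊗ P∞ (suc n) ⊗ qPoch (z n) n
  F₀≈P∞1 : F 0 ≈ P∞ 1
  F₀≈P∞1 = begin
    qpow 0 ⊗ P∞ 1 ⊗ one   ≈⟨ *-identityʳ (qpow 0 ⊗ P∞ 1) ⟩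
    qpow 0 ⊗ P∞ 1         ≈⟨ ⊗-congʳ (P∞ 1) qpow-zero ⟩
    one ⊗ P∞ 1            ≈⟨ *-identityˡ (P∞ 1) ⟩
    P∞ 1                  ∎
  drop-head : ∀ x y → x ⊕ y ⊖ x ≈ y
  drop-head = solve 2 (λ x y → x :+ y :- x := y) ≈-refl

pentagonal-tail : neg (sumFrom1 (λ i → sgn i ⊗ qpow (pent⁻ i)))
                  ≈ sumFrom1 (λ n → (-1ℤ ^ suc n) · qpow (pent n))
pentagonal-tail = coeffwise λ k →
  trans (sym (sumBelow-neg k (λ i → (sgn (suc i) ⊗ qpow (pent⁻ (suc i))) k))) (sumBelow-cong k (term k))
  where
  term : ∀ k i → - (sgn (suc i) ⊗ qpow (pent⁻ (suc i))) k ≡ (-1ℤ ^ suc (suc i)) ℤ.* qpow (pent (suc i)) k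
  term k i = begin
    - (sgn (suc i) ⊗ qpow (pent⁻ (suc i))) k
      ≡⟨ cong -_ (const-⊗ (-1ℤ ^ suc i) (qpow (pent⁻ (suc i))) k) ⟩
    - (-1ℤ ^ suc i ℤ.* qpow (pent⁻ (suc i)) k)
      ≡⟨ ℤ.neg-distribˡ-* (-1ℤ ^ suc i) (qpow (pent⁻ (suc i)) k) ⟩
    - (-1ℤ ^ suc i) ℤ.* qpow (pent⁻ (suc i)) k
      ≡⟨ cong (ℤ._* qpow (pent⁻ (suc i)) k) (sym (ℤ.-1*i≡-i (-1ℤ ^ suc i))) ⟩
    -1ℤ ^ suc (suc i) ℤ.* qpow (pent⁻ (suc i)) k
      ≡⟨ cong (λ m → -1ℤ ^ suc (suc i) ℤ.* qpow m k) (sym (pent≡pent⁻ (suc i))) ⟩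
    -1ℤ ^ suc (suc i) ℤ.* qpow (pent (suc i)) k
      ∎
    where open ≡-Reasoning

identity-a : sumFrom1 (λ n → qpow n ⊗ qPochInf (qpow (suc n)) ⊗ qPoch (qpow n) n)
             ≈ sumFrom1 (λ n → (-1ℤ ^ suc n) · qpow (pent n))
identity-a = begin
  sumFrom1 (λ n → qpow n ⊗ P∞ (suc n) ⊗ qPoch (qpow n) n)
    ≈⟨ sumFrom1-qPoch-scaled 1ℤ (λ n → ≈-sym (*-identityˡ (qpow n))) ⟩
  A ⊖ P∞ 1
    ≈⟨ ⊖-congˡ A euler ⟩
  A ⊖ (A ⊕ B)
    ≈⟨ cancel A B ⟩
  neg B
    ≈⟨ pentagonal-tail ⟩
  sumFrom1 (λ n → (-1ℤ ^ suc n) · qpow (pent n))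
    ∎
  where
  open ≈-Reasoning
  A B : PS
  A = sumFrom0 (λ j → sgn j ⊗ qpow (pent⁺ j))
  B = sumFrom1 (λ i → sgn i ⊗ qpow (pent⁻ i))
  cancel : ∀ a b → a ⊖ (a ⊕ b) ≈ neg b
  cancel = solve 2 (λ a b → a :- (a :+ b) := :- b) ≈-refl

identity-b : sumFrom1 (λ n → qpow n ⊗ qPochInf (qpow (suc n)) ⊗ qPoch (neg (qpow n)) n)
             ≈ sumFrom1 (λ n → (-1ℤ ^ suc n) · qpow (pent n))
               ⊕ (+ 2) · sumFrom0 (λ n → qpow (6 * n * n + 7 * n + 2))
identity-b = begin
  sumFrom1 (λ n → qpow n ⊗ P∞ (suc n) ⊗ qPoch (neg (qpow n)) n)
    ≈⟨ sumFrom1-qPoch-scaled -1ℤ -qⁿ≈-1·qⁿ ⟩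
  A′ ⊖ P∞ 1
    ≈⟨ ⊖-congˡ A′ euler ⟩
  A′ ⊖ (A ⊕ B)
    ≈⟨ regroup A′ A B ⟩
  neg B ⊕ (A′ ⊖ A)
    ≈⟨ +-cong pentagonal-tail odd-terms ⟩
  sumFrom1 (λ n → (-1ℤ ^ suc n) · qpow (pent n)) ⊕ (+ 2) · sumFrom0 (λ n → qpow (6 * n * n + 7 * n + 2))
    ∎
  where
  open ≈-Reasoning
  A′ A B : PS
  A′ = sumFrom0 (λ j → const (1ℤ ^ j) ⊗ qpow (pent⁺ j))
  A  = sumFrom0 (λ j → sgn j ⊗ qpow (pent⁺ j))
  B  = sumFrom1 (λ i → sgn i ⊗ qpow (pent⁻ i))
  -qⁿ≈-1·qⁿ : ∀ n → neg (qpow n) ≈ const -1ℤ ⊗ qpow n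
  -qⁿ≈-1·qⁿ n = coeffwise λ k → sym (trans (const-⊗ -1ℤ (qpow n) k) (ℤ.-1*i≡-i (qpow n k)))
  regroup : ∀ a′ a b → a′ ⊖ (a ⊕ b) ≈ neg b ⊕ (a′ ⊖ a)
  regroup = solve 3 (λ a′ a b → a′ :- (a :+ b) := :- b :+ (a′ :- a)) ≈-refl
  1^j-dropped : ∀ j → const (1ℤ ^ j) ⊗ qpow (pent⁺ j) ≈ qpow (pent⁺ j)
  1^j-dropped j =
    ≈-trans (⊗-congʳ (qpow (pent⁺ j)) (≈-reflexive (cong const (ℤ.^-zeroˡ j)))) (*-identityˡ (qpow (pent⁺ j)))
  odd-terms : A′ ⊖ A ≈ (+ 2) · sumFrom0 (λ n → qpow (6 * n * n + 7 * n + 2))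
  odd-terms = begin
    A′ ⊖ A
      ≈⟨ +-cong (sumFrom0-cong 1^j-dropped) (≈-refl {neg A}) ⟩
    sumFrom0 (λ j → qpow (pent⁺ j)) ⊖ A
      ≈⟨ sumFrom0-minus-alternating pent⁺ (λ j → ℕ.m≤n+m j (pent⁻ j)) ⟩
    (+ 2) · sumFrom0 (λ n → qpow (pent⁺ (suc (2 * n))))
      ≈⟨ coeffwise (λ k → cong (+ 2 ℤ.*_) (coeff (sumFrom0-cong (λ n → qpow-cong (pent⁺-odd n))) k)) ⟩
    (+ 2) · sumFrom0 (λ n → qpow (6 * n * n + 7 * n + 2))
      ∎

theorem1p1 : (∀ k → sumFrom1 (λ n → qpow n ⊗ qPochInf (qpow (suc n)) ⊗ qPoch (qpow n) n) k
                    ≡ sumFrom1 (λ n → (-1ℤ ^ (suc n)) · qpow (pent n)) k)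
             × (∀ k → sumFrom1 (λ n → qpow n ⊗ qPochInf (qpow (suc n)) ⊗ qPoch (neg (qpow n)) n) k
                    ≡ (sumFrom1 (λ n → (-1ℤ ^ (suc n)) · qpow (pent n))
                       ⊕ (+ 2) · sumFrom0 (λ n → qpow (6 * n * n + 7 * n + 2))) k)
theorem1p1 = coeff identity-a , coeff identity-b
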